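{- Let $q=p^s$ be an odd prime power. In all cases $M_0(x^{\frac{q-1}{2}},0)=q-3$, $M_1(x^{\frac{q-1}{2}},0)=1$, $M_{\frac{q-1}{2}}(x^{\frac{q-1}{2}},0)=2$. If $q\equiv1\pmod4$ and $c\neq0$: $M_0(x^{\frac{q-1}{2}},c)=\frac{q+3}{4}$, $M_1(x^{\frac{q-1}{2}},c)=\frac{q-3}{2}$, $M_2(x^{\frac{q-1}{2}},c)=\frac{q+3}{4}$. If $q\equiv3\pmod4$: for $c\in C_0^{(2,q)}$, $M_0(x^{\frac{q-1}{2}},c)=\frac{q+5}{4}-\delta_{p,s}$, $M_1(x^{\frac{q-1}{2}},c)=\frac{q-3}{2}+2\delta_{p,s}$, $M_2(x^{\frac{q-1}{2}},c)=\frac{q-3}{4}-\delta_{p,s}$, $M_3(x^{\frac{q-1}{2}},c)=1$; for $c\in C_1^{(2,q)}$, $M_0(x^{\frac{q-1}{2}},c)=\frac{q-3}{4}+\delta_{p,s}$, $M_1(x^{\frac{q-1}{2}},c)=\frac{q+3}{2}-2\delta_{p,s}$, $M_2(x^{\frac{q-1}{2}},c)=\frac{q-3}{4}+\delta_{p,s}$. In each case all $M_j$ not listed are $0$.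
   Context: For a polynomial $f$ over $\mathbb{F}_q$ and $c\in\mathbb{F}_q$, $M_j(f,c)$ is the number of elements of $\mathbb{F}_q$ occurring exactly $j$ times in the multiset $\{f(x)-cx\mid x\in\mathbb{F}_q\}$. $C_0^{(2,q)}$ is the set of nonzero squares and $C_1^{(2,q)}$ the set of nonsquares of $\mathbb{F}_q$. $\delta_{p,s}=1$ if $2\in C_0^{(2,q)}$ and $\delta_{p,s}=0$ otherwise. -}

module Defs where

open import Data.Nat using (ℕ; zero; suc)
import Data.Nat as ℕ
open import Data.Fin using (Fin)
open import Data.List using (List; length; filter; map)
open import Data.List.Base using (allFin)
open import Data.Product using (∃; _×_)
open import Relation.Nullary using (¬_)
open import Relation.Binary.PropositionalEquality using (_≡_)
open import Relation.Binary.Definitions using (DecidableEquality)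
open import Algebra.Core using (Op₁; Op₂)
open import Algebra.Structures using (IsCommutativeRing)
open import Function.Bundles using (_↔_; Inverse)

record FiniteField (q : ℕ) : Set₁ where
  infixl 6 _+_
  infixl 7 _*_
  field
    Carrier : Set
    _+_ _*_ : Op₂ Carrier
    -_ : Op₁ Carrier
    0# 1# : Carrier
    isCommutativeRing : IsCommutativeRing _≡_ _+_ _*_ -_ 0# 1#
    0≢1 : ¬ (0# ≡ 1#)
    inverse : ∀ x → ¬ (x ≡ 0#) → ∃ λ y → x * y ≡ 1#
    _≟_ : DecidableEquality Carrier
    enum : Fin q ↔ Carrier

module FF {q : ℕ} (F : FiniteField q) where
  open FiniteField F public using (Carrier; 0#; 1#)
  open FiniteField F using (_+_; _*_; -_; _≟_; enum)

  infixl 6 _-_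
  _-_ : Op₂ Carrier
  a - b = a + (- b)

  infixr 8 _^ᶠ_
  _^ᶠ_ : Carrier → ℕ → Carrier
  x ^ᶠ zero = 1#
  x ^ᶠ suc n = x * (x ^ᶠ n)

  two : Carrier
  two = 1# + 1#

  elements : List Carrier
  elements = map (Inverse.to enum) (allFin q)

  IsSquare : Carrier → Set
  IsSquare a = ∃ λ b → b * b ≡ a

  C₀ : Carrier → Set
  C₀ a = ¬ (a ≡ 0#) × IsSquare a

  C₁ : Carrier → Set
  C₁ a = ¬ (a ≡ 0#) × ¬ IsSquare a

  mult : (Carrier → Carrier) → Carrier → Carrier → ℕ
  mult f c y = length (filter (λ x → (f x - c * x) ≟ y) elements)

  M : ℕ → (Carrier → Carrier) → Carrier → ℕ
  M j f c = length (filter (λ y → mult f c y ℕ.≟ j) elements)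

module Submission where

-- Write χ(x) = x^k.  By Fermat and a root count (Euler's criterion) χ is 0 at 0,
-- 1 on the k nonzero squares and -1 on the k nonsquares, so f(x) = χ(x) - c x
-- is determined by the class of x.
--   * c = 0: the values 0, 1, -1 are taken 1, k and k times.
--   * c ≠ 0: writing the values as 1 - c u, the multiplicity at u is
--     [u = 1/c] + [u ∈ C₀] + [u - 2/c ∈ C₁].  Apart from the point u = 1/c this
--     is a sum s of two indicators, whose level counts are fixed by
--     β = #{u ∈ C₀ : u - 2/c ∈ C₁}.  Counting solutions of x² - y² = d (there are
--     q - 1 of them) determines β; the parity of k (i.e. q mod 4) decides whether
--     -1 is a square, and the classes of c and 2 decide the correction at 1/c.

open import Data.Nat as ℕ using (ℕ; zero; suc)
open import Relation.Binary.PropositionalEquality using (_≡_)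
open import Relation.Nullary using (¬_)
open import Level using (0ℓ)
open import Algebra.Core using (Op₁; Op₂)
open import Algebra.Structures using (IsCommutativeRing)
open import Defs using (FiniteField; module FF)

module Counting where
  open import Data.Nat using (_+_; _*_; _≤_; z≤n)
  import Data.Nat.Properties as ℕP
  open import Data.Fin as Fin using (Fin; zero; suc)
  import Data.Fin.Properties as FinP
  open import Data.Fin.Permutation using (Permutation; permutation)
  open import Data.List using (length; filter; map; tabulate)
  open import Data.List.Base using (allFin)
  open import Data.List.Properties using (map-tabulate)
  open import Data.Empty using (⊥-elim)
  open import Algebra.Bundles using (CommutativeMonoid)
  import Algebra.Properties.CommutativeMonoid.Sum as MonoidSum
  open import Function.Bundles using (_↔_; Inverse)
  open import Relation.Nullary using (¬_; Dec; yes; no)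
  open import Relation.Nullary.Decidable using (¬?)
  open import Relation.Unary using (Decidable)
  open import Relation.Binary.Definitions using (DecidableEquality)
  open import Relation.Binary.PropositionalEquality
  open ≡-Reasoning

  𝟙 : ∀ {a} {P : Set a} → Dec P → ℕ
  𝟙 (yes _) = 1
  𝟙 (no _) = 0

  𝟙-cong : ∀ {a b} {P : Set a} {Q : Set b} (p? : Dec P) (q? : Dec Q) → (P → Q) → (Q → P) → 𝟙 p? ≡ 𝟙 q?
  𝟙-cong (yes _) (yes _) _ _ = refl
  𝟙-cong (yes p) (no ¬q) to _ = ⊥-elim (¬q (to p))
  𝟙-cong (no ¬p) (yes q) _ from = ⊥-elim (¬p (from q))
  𝟙-cong (no _) (no _) _ _ = refl

  𝟙-yes : ∀ {a} {P : Set a} (p? : Dec P) → P → 𝟙 p? ≡ 1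
  𝟙-yes (yes _) _ = refl
  𝟙-yes (no ¬p) p = ⊥-elim (¬p p)

  𝟙-no : ∀ {a} {P : Set a} (p? : Dec P) → ¬ P → 𝟙 p? ≡ 0
  𝟙-no (yes p) ¬p = ⊥-elim (¬p p)
  𝟙-no (no _) _ = refl

  𝟙-complement : ∀ {a} {P : Set a} (p? : Dec P) → 𝟙 p? + 𝟙 (¬? p?) ≡ 1
  𝟙-complement (yes _) = refl
  𝟙-complement (no _) = refl

  sum-pick : ∀ n (j : Fin n) (h : Fin n → ℕ) →
    MonoidSum.sum ℕP.+-0-commutativeMonoid (λ i → 𝟙 (i Fin.≟ j) * h i) ≡ h j
  sum-pick (suc n) zero h = begin
    h zero + 0 + ∑ (λ i → 𝟙 (suc i Fin.≟ zero) * h (suc i))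
      ≡⟨ cong₂ _+_ (ℕP.+-identityʳ (h zero)) (trans (∑-cong-≗ (λ i → cong (_* h (suc i)) (𝟙-no (suc i Fin.≟ zero) λ ())))
                                                     (∑-zero n)) ⟩
    h zero + 0
      ≡⟨ ℕP.+-identityʳ (h zero) ⟩
    h zero ∎
    where
    open MonoidSum ℕP.+-0-commutativeMonoid renaming (sum to ∑; sum-cong-≗ to ∑-cong-≗)
    ∑-zero : ∀ m → ∑ {m} (λ _ → 0) ≡ 0
    ∑-zero zero = refl
    ∑-zero (suc m) = ∑-zero m
  sum-pick (suc n) (suc j) h = begin
    𝟙 (zero Fin.≟ suc j) * h zero + ∑ (λ i → 𝟙 (suc i Fin.≟ suc j) * h (suc i))
      ≡⟨ cong₂ _+_ (cong (_* h zero) (𝟙-no (zero Fin.≟ suc j) λ ()))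
                   (∑-cong-≗ (λ i → cong (_* h (suc i)) (𝟙-cong (suc i Fin.≟ suc j) (i Fin.≟ j) FinP.suc-injective (cong suc)))) ⟩
    ∑ (λ i → 𝟙 (i Fin.≟ j) * h (suc i))
      ≡⟨ sum-pick n j (λ i → h (suc i)) ⟩
    h (suc j) ∎
    where open MonoidSum ℕP.+-0-commutativeMonoid renaming (sum to ∑; sum-cong-≗ to ∑-cong-≗)

  module FiniteSum {A : Set} {n : ℕ} (enum : Fin n ↔ A) where

    open Inverse enum using (to; from) renaming (strictlyInverseˡ to to-from; strictlyInverseʳ to from-to)

    module InMonoid (M : CommutativeMonoid 0ℓ 0ℓ) where
      open CommutativeMonoid M using (Carrier; _≈_) renaming (trans to ≈-trans; reflexive to ≈-reflexive)
      open MonoidSum M public using (sum; sum-cong-≗; ∑-distrib-+)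
      open import Algebra.Definitions.RawMonoid (CommutativeMonoid.rawMonoid M) public using (_×_)
      open MonoidSum M using (∑-permute; sum-replicate)

      ⨁ : (A → Carrier) → Carrier
      ⨁ f = sum (λ i → f (to i))

      ⨁-const : ∀ x → ⨁ (λ _ → x) ≈ n × x
      ⨁-const x = sum-replicate n

      ⨁-reindex : (σ τ : A → A) → (∀ x → σ (τ x) ≡ x) → (∀ x → τ (σ x) ≡ x) →
                  ∀ f → ⨁ f ≈ ⨁ (λ x → f (σ x))
      ⨁-reindex σ τ στ τσ f =
        ≈-trans (∑-permute (λ i → f (to i)) π) (≈-reflexive (sum-cong-≗ (λ i → cong f (to-from (σ (to i))))))
        where
        inverse-on-Fin : (σ τ : A → A) → (∀ x → σ (τ x) ≡ x) → ∀ i → from (σ (to (from (τ (to i))))) ≡ i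
        inverse-on-Fin σ τ στ i = begin
          from (σ (to (from (τ (to i))))) ≡⟨ cong (λ y → from (σ y)) (to-from (τ (to i))) ⟩
          from (σ (τ (to i)))             ≡⟨ cong from (στ (to i)) ⟩
          from (to i)                     ≡⟨ from-to i ⟩
          i                               ∎
        π : Permutation n n
        π = permutation (λ i → from (σ (to i))) (λ i → from (τ (to i)))
              (inverse-on-Fin σ τ στ) (inverse-on-Fin τ σ τσ)

    open InMonoid ℕP.+-0-commutativeMonoid public
      using () renaming (⨁ to Σ; ⨁-reindex to Σ-reindex)
    open InMonoid ℕP.+-0-commutativeMonoid using (sum; sum-cong-≗; ∑-distrib-+)
    open MonoidSum ℕP.+-0-commutativeMonoid using (∑-comm)

    Σ-cong : ∀ {f g : A → ℕ} → (∀ x → f x ≡ g x) → Σ f ≡ Σ g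
    Σ-cong f≗g = sum-cong-≗ (λ i → f≗g (to i))

    Σ-+ : ∀ (f g : A → ℕ) → Σ (λ x → f x + g x) ≡ Σ f + Σ g
    Σ-+ f g = ∑-distrib-+ (λ i → f (to i)) (λ i → g (to i))

    Σ-swap : ∀ (g : A → A → ℕ) → Σ (λ x → Σ (λ y → g x y)) ≡ Σ (λ y → Σ (λ x → g x y))
    Σ-swap g = ∑-comm (λ i j → g (to i) (to j))

    Σ-const : ∀ k → Σ (λ _ → k) ≡ n * k
    Σ-const k = go n
      where
      go : ∀ m → sum {m} (λ _ → k) ≡ m * k
      go zero = refl
      go (suc m) = cong (k +_) (go m)

    Σ-zero : ∀ (f : A → ℕ) → (∀ x → f x ≡ 0) → Σ f ≡ 0
    Σ-zero f f≗0 = trans (Σ-cong f≗0) (trans (Σ-const 0) (ℕP.*-zeroʳ n))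

    Σ-*ˡ : ∀ k (f : A → ℕ) → Σ (λ x → k * f x) ≡ k * Σ f
    Σ-*ˡ k f = go n (λ i → f (to i))
      where
      go : ∀ m (g : Fin m → ℕ) → sum (λ i → k * g i) ≡ k * sum g
      go zero g = sym (ℕP.*-zeroʳ k)
      go (suc m) g = trans (cong (k * g zero +_) (go m (λ i → g (suc i))))
                           (sym (ℕP.*-distribˡ-+ k (g zero) (sum (λ i → g (suc i)))))

    Σ-*ʳ : ∀ (f : A → ℕ) k → Σ (λ x → f x * k) ≡ Σ f * k
    Σ-*ʳ f k = trans (Σ-cong (λ x → ℕP.*-comm (f x) k)) (trans (Σ-*ˡ k f) (ℕP.*-comm k (Σ f)))

    Σ-mono : ∀ (f g : A → ℕ) → (∀ x → f x ≤ g x) → Σ f ≤ Σ g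
    Σ-mono f g f≤g = go n (λ i → f (to i)) (λ i → g (to i)) (λ i → f≤g (to i))
      where
      go : ∀ m (f g : Fin m → ℕ) → (∀ i → f i ≤ g i) → sum f ≤ sum g
      go zero f g _ = z≤n
      go (suc m) f g f≤g = ℕP.+-mono-≤ (f≤g zero) (go m _ _ (λ i → f≤g (suc i)))

    Σ-restrict-cong : ∀ {P : A → Set} (P? : Decidable P) {g g' : A → ℕ} → (∀ x → P x → g x ≡ g' x) →
      Σ (λ x → 𝟙 (P? x) * g x) ≡ Σ (λ x → 𝟙 (P? x) * g' x)
    Σ-restrict-cong P? {g} {g'} agree = Σ-cong pointwise
      where
      pointwise : ∀ x → 𝟙 (P? x) * g x ≡ 𝟙 (P? x) * g' x
      pointwise x with P? x
      ... | yes p = cong (_+ 0) (agree x p)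
      ... | no _ = refl

    length-filter : ∀ {P : A → Set} (P? : Decidable P) → length (filter P? (map to (allFin n))) ≡ Σ (λ x → 𝟙 (P? x))
    length-filter P? = trans (cong (λ xs → length (filter P? xs)) (map-tabulate (λ i → i) to)) (go n to)
      where
      go : ∀ m (h : Fin m → A) → length (filter P? (tabulate h)) ≡ sum (λ i → 𝟙 (P? (h i)))
      go zero h = refl
      go (suc m) h with P? (h zero)
      ... | yes _ = cong suc (go m (λ i → h (suc i)))
      ... | no _ = go m (λ i → h (suc i))

    level : (A → ℕ) → ℕ → ℕ
    level g j = Σ (λ u → 𝟙 (g u ℕ.≟ j))

    level-cong : ∀ {g g' : A → ℕ} → (∀ u → g u ≡ g' u) → ∀ j → level g j ≡ level g' j
    level-cong g≗g' j = Σ-cong (λ u → cong (λ v → 𝟙 (v ℕ.≟ j)) (g≗g' u))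

    level-reindex : ∀ (σ τ : A → A) → (∀ x → σ (τ x) ≡ x) → (∀ x → τ (σ x) ≡ x) →
      ∀ (g : A → ℕ) j → level g j ≡ level (λ u → g (σ u)) j
    level-reindex σ τ στ τσ g j = Σ-reindex σ τ στ τσ (λ y → 𝟙 (g y ℕ.≟ j))

    module TwoIndicators {P Q : A → Set} (P? : Decidable P) (Q? : Decidable Q) where

      s : A → ℕ
      s u = 𝟙 (P? u) + 𝟙 (Q? u)

      both : ℕ
      both = Σ (λ u → 𝟙 (P? u) * 𝟙 (Q? u))

      private
        at-2 : ∀ {a b} {X : Set a} {Y : Set b} (x? : Dec X) (y? : Dec Y) → 𝟙 ((𝟙 x? + 𝟙 y?) ℕ.≟ 2) ≡ 𝟙 x? * 𝟙 y?
        at-2 (yes _) (yes _) = refl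
        at-2 (yes _) (no _) = refl
        at-2 (no _) (yes _) = refl
        at-2 (no _) (no _) = refl

        at-1 : ∀ {a b} {X : Set a} {Y : Set b} (x? : Dec X) (y? : Dec Y) →
               𝟙 ((𝟙 x? + 𝟙 y?) ℕ.≟ 1) + 2 * (𝟙 x? * 𝟙 y?) ≡ 𝟙 x? + 𝟙 y?
        at-1 (yes _) (yes _) = refl
        at-1 (yes _) (no _) = refl
        at-1 (no _) (yes _) = refl
        at-1 (no _) (no _) = refl

        at-0 : ∀ {a b} {X : Set a} {Y : Set b} (x? : Dec X) (y? : Dec Y) →
               𝟙 ((𝟙 x? + 𝟙 y?) ℕ.≟ 0) + (𝟙 x? + 𝟙 y?) ≡ 1 + 𝟙 x? * 𝟙 y?
        at-0 (yes _) (yes _) = refl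
        at-0 (yes _) (no _) = refl
        at-0 (no _) (yes _) = refl
        at-0 (no _) (no _) = refl

        above-2 : ∀ {a b} {X : Set a} {Y : Set b} (x? : Dec X) (y? : Dec Y) →
                  ∀ j → ¬ j ≡ 0 → ¬ j ≡ 1 → ¬ j ≡ 2 → 𝟙 ((𝟙 x? + 𝟙 y?) ℕ.≟ j) ≡ 0
        above-2 (yes _) (yes _) j _ _ j≢2 = 𝟙-no (2 ℕ.≟ j) (λ e → j≢2 (sym e))
        above-2 (yes _) (no _) j _ j≢1 _ = 𝟙-no (1 ℕ.≟ j) (λ e → j≢1 (sym e))
        above-2 (no _) (yes _) j _ j≢1 _ = 𝟙-no (1 ℕ.≟ j) (λ e → j≢1 (sym e))
        above-2 (no _) (no _) j j≢0 _ _ = 𝟙-no (0 ℕ.≟ j) (λ e → j≢0 (sym e))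

      level-2 : level s 2 ≡ both
      level-2 = Σ-cong (λ u → at-2 (P? u) (Q? u))

      level-1 : level s 1 + 2 * both ≡ Σ (λ u → 𝟙 (P? u)) + Σ (λ u → 𝟙 (Q? u))
      level-1 = begin
        level s 1 + 2 * both
          ≡⟨ cong (level s 1 +_) (sym (Σ-*ˡ 2 (λ u → 𝟙 (P? u) * 𝟙 (Q? u)))) ⟩
        level s 1 + Σ (λ u → 2 * (𝟙 (P? u) * 𝟙 (Q? u)))
          ≡⟨ sym (Σ-+ (λ u → 𝟙 (s u ℕ.≟ 1)) (λ u → 2 * (𝟙 (P? u) * 𝟙 (Q? u)))) ⟩
        Σ (λ u → 𝟙 (s u ℕ.≟ 1) + 2 * (𝟙 (P? u) * 𝟙 (Q? u)))
          ≡⟨ Σ-cong (λ u → at-1 (P? u) (Q? u)) ⟩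
        Σ s
          ≡⟨ Σ-+ (λ u → 𝟙 (P? u)) (λ u → 𝟙 (Q? u)) ⟩
        Σ (λ u → 𝟙 (P? u)) + Σ (λ u → 𝟙 (Q? u)) ∎

      level-0 : level s 0 + (Σ (λ u → 𝟙 (P? u)) + Σ (λ u → 𝟙 (Q? u))) ≡ n + both
      level-0 = begin
        level s 0 + (Σ (λ u → 𝟙 (P? u)) + Σ (λ u → 𝟙 (Q? u)))
          ≡⟨ cong (level s 0 +_) (sym (Σ-+ (λ u → 𝟙 (P? u)) (λ u → 𝟙 (Q? u)))) ⟩
        level s 0 + Σ s
          ≡⟨ sym (Σ-+ (λ u → 𝟙 (s u ℕ.≟ 0)) s) ⟩
        Σ (λ u → 𝟙 (s u ℕ.≟ 0) + s u)
          ≡⟨ Σ-cong (λ u → at-0 (P? u) (Q? u)) ⟩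
        Σ (λ u → 1 + 𝟙 (P? u) * 𝟙 (Q? u))
          ≡⟨ Σ-+ (λ _ → 1) (λ u → 𝟙 (P? u) * 𝟙 (Q? u)) ⟩
        Σ (λ _ → 1) + both
          ≡⟨ cong (_+ both) (trans (Σ-const 1) (ℕP.*-identityʳ n)) ⟩
        n + both ∎

      level-above-2 : ∀ j → ¬ j ≡ 0 → ¬ j ≡ 1 → ¬ j ≡ 2 → level s j ≡ 0
      level-above-2 j j≢0 j≢1 j≢2 = Σ-zero _ (λ u → above-2 (P? u) (Q? u) j j≢0 j≢1 j≢2)

    module Points (_≟_ : DecidableEquality A) where

      [_≐_] : A → A → ℕ
      [ a ≐ b ] = 𝟙 (a ≟ b)

      ≐-sym : ∀ a b → [ a ≐ b ] ≡ [ b ≐ a ]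
      ≐-sym a b = 𝟙-cong (a ≟ b) (b ≟ a) sym sym

      Σ-point : ∀ a (g : A → ℕ) → Σ (λ x → [ x ≐ a ] * g x) ≡ g a
      Σ-point a g = begin
        Σ (λ x → [ x ≐ a ] * g x)
          ≡⟨ Σ-cong (λ x → cong (_* g x) (𝟙-cong (x ≟ a) (from x Fin.≟ from a) (cong from) from-injective)) ⟩
        sum (λ i → 𝟙 (from (to i) Fin.≟ from a) * g (to i))
          ≡⟨ sum-cong-≗ (λ i → cong (λ j → 𝟙 (j Fin.≟ from a) * g (to i)) (from-to i)) ⟩
        sum (λ i → 𝟙 (i Fin.≟ from a) * g (to i))
          ≡⟨ sum-pick n (from a) (λ i → g (to i)) ⟩
        g (to (from a))
          ≡⟨ cong g (to-from a) ⟩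
        g a ∎
        where
        from-injective : ∀ {x} → from x ≡ from a → x ≡ a
        from-injective {x} e = trans (sym (to-from x)) (trans (cong to e) (to-from a))

      Σ-point1 : ∀ a → Σ (λ x → [ x ≐ a ]) ≡ 1
      Σ-point1 a = trans (Σ-cong (λ x → sym (ℕP.*-identityʳ [ x ≐ a ]))) (Σ-point a (λ _ → 1))

      level-update : ∀ (g g' : A → ℕ) a → (∀ u → ¬ u ≡ a → g u ≡ g' u) → ∀ j →
        level g' j + 𝟙 (g a ℕ.≟ j) ≡ level g j + 𝟙 (g' a ℕ.≟ j)
      level-update g g' a agree j = begin
        level g' j + 𝟙 (g a ℕ.≟ j)
          ≡⟨ cong (level g' j +_) (sym (Σ-point a (λ u → 𝟙 (g u ℕ.≟ j)))) ⟩
        level g' j + Σ (λ u → [ u ≐ a ] * 𝟙 (g u ℕ.≟ j))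
          ≡⟨ sym (Σ-+ (λ u → 𝟙 (g' u ℕ.≟ j)) (λ u → [ u ≐ a ] * 𝟙 (g u ℕ.≟ j))) ⟩
        Σ (λ u → 𝟙 (g' u ℕ.≟ j) + [ u ≐ a ] * 𝟙 (g u ℕ.≟ j))
          ≡⟨ Σ-cong pointwise ⟩
        Σ (λ u → 𝟙 (g u ℕ.≟ j) + [ u ≐ a ] * 𝟙 (g' u ℕ.≟ j))
          ≡⟨ Σ-+ (λ u → 𝟙 (g u ℕ.≟ j)) (λ u → [ u ≐ a ] * 𝟙 (g' u ℕ.≟ j)) ⟩
        level g j + Σ (λ u → [ u ≐ a ] * 𝟙 (g' u ℕ.≟ j))
          ≡⟨ cong (level g j +_) (Σ-point a (λ u → 𝟙 (g' u ℕ.≟ j))) ⟩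
        level g j + 𝟙 (g' a ℕ.≟ j) ∎
        where
        pointwise : ∀ u → 𝟙 (g' u ℕ.≟ j) + [ u ≐ a ] * 𝟙 (g u ℕ.≟ j) ≡ 𝟙 (g u ℕ.≟ j) + [ u ≐ a ] * 𝟙 (g' u ℕ.≟ j)
        pointwise u with u ≟ a
        ... | yes refl = begin
          𝟙 (g' u ℕ.≟ j) + (𝟙 (g u ℕ.≟ j) + 0)  ≡⟨ cong (𝟙 (g' u ℕ.≟ j) +_) (ℕP.+-identityʳ _) ⟩
          𝟙 (g' u ℕ.≟ j) + 𝟙 (g u ℕ.≟ j)        ≡⟨ ℕP.+-comm (𝟙 (g' u ℕ.≟ j)) (𝟙 (g u ℕ.≟ j)) ⟩
          𝟙 (g u ℕ.≟ j) + 𝟙 (g' u ℕ.≟ j)        ≡⟨ cong (𝟙 (g u ℕ.≟ j) +_) (sym (ℕP.+-identityʳ _)) ⟩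
          𝟙 (g u ℕ.≟ j) + (𝟙 (g' u ℕ.≟ j) + 0)  ∎
        ... | no u≢a rewrite agree u u≢a = refl

-- Integer coefficients (rather than the ring's
-- own elements) make normal forms cancel syntactically, e.g. x - x to 0.
module IntegerSolver {A : Set} {add mul : Op₂ A} {neg : Op₁ A} {0ᴬ 1ᴬ : A}
  (isCommutativeRing : IsCommutativeRing _≡_ add mul neg 0ᴬ 1ᴬ) where
  open import Relation.Binary.PropositionalEquality

  import Data.Nat.Properties as ℕP
  import Data.Integer as ℤ
  open ℤ using (ℤ)
  import Data.Integer.Properties as ℤP
  open import Data.Sign as Sign using (Sign)
  open import Data.Maybe using (just; nothing)
  open import Relation.Nullary using (yes; no)
  open import Algebra.Bundles using (CommutativeRing)
  open import Algebra.Solver.Ring.AlmostCommutativeRing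
    using (fromCommutativeRing; _-Raw-AlmostCommutative⟶_; Induced-equivalence)
  open import Relation.Binary.Definitions using (WeaklyDecidable)

  commutativeRing : CommutativeRing 0ℓ 0ℓ
  commutativeRing = record { isCommutativeRing = isCommutativeRing }

  open CommutativeRing commutativeRing using (_+_; _*_; -_; 0#; 1#; ring; +-assoc; +-comm; +-identityˡ; +-identityʳ; -‿inverseʳ; zeroˡ; *-identityˡ; distribʳ)
  import Algebra.Properties.Ring ring as RingProps

  -- The image n · 1 of a natural number, written so that 1 ↦ 1# and 2 ↦ 1# + 1#
  -- hold definitionally; solver constants then match the field's own 1# and two.
  infix 8 _·1
  _·1 : ℕ → A
  zero ·1 = 0#
  suc zero ·1 = 1#
  suc (suc n) ·1 = 1# + suc n ·1

  ·1-suc : ∀ n → suc n ·1 ≡ 1# + n ·1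
  ·1-suc zero = sym (+-identityʳ 1#)
  ·1-suc (suc n) = refl

  ·1-+ : ∀ m n → (m ℕ.+ n) ·1 ≡ m ·1 + n ·1
  ·1-+ zero n = sym (+-identityˡ _)
  ·1-+ (suc m) n = begin
    suc (m ℕ.+ n) ·1      ≡⟨ ·1-suc (m ℕ.+ n) ⟩
    1# + (m ℕ.+ n) ·1     ≡⟨ cong (1# +_) (·1-+ m n) ⟩
    1# + (m ·1 + n ·1)    ≡⟨ sym (+-assoc 1# (m ·1) (n ·1)) ⟩
    (1# + m ·1) + n ·1    ≡⟨ cong (_+ n ·1) (sym (·1-suc m)) ⟩
    suc m ·1 + n ·1       ∎
    where open ≡-Reasoning

  ·1-* : ∀ m n → (m ℕ.* n) ·1 ≡ m ·1 * n ·1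
  ·1-* zero n = sym (zeroˡ _)
  ·1-* (suc m) n = begin
    (n ℕ.+ m ℕ.* n) ·1        ≡⟨ ·1-+ n (m ℕ.* n) ⟩
    n ·1 + (m ℕ.* n) ·1       ≡⟨ cong (n ·1 +_) (·1-* m n) ⟩
    n ·1 + m ·1 * n ·1        ≡⟨ cong (_+ m ·1 * n ·1) (sym (*-identityˡ (n ·1))) ⟩
    1# * n ·1 + m ·1 * n ·1   ≡⟨ sym (distribʳ (n ·1) 1# (m ·1)) ⟩
    (1# + m ·1) * n ·1        ≡⟨ cong (_* n ·1) (sym (·1-suc m)) ⟩
    suc m ·1 * n ·1           ∎
    where open ≡-Reasoning

  ⟦_⟧ᶻ : ℤ → A
  ⟦ ℤ.+ n ⟧ᶻ = n ·1
  ⟦ ℤ.-[1+ n ] ⟧ᶻ = - (suc n ·1)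

  signed : Sign → A → A
  signed Sign.+ x = x
  signed Sign.- x = - x

  private
    -‿+ : ∀ x y → - (x + y) ≡ - x + - y
    -‿+ x y = sym (RingProps.-‿+-comm x y)

    cancel-left : ∀ c a b → (c + a) + - (c + b) ≡ a + - b
    cancel-left c a b = begin
      (c + a) + - (c + b)     ≡⟨ cong₂ _+_ (+-comm c a) (-‿+ c b) ⟩
      (a + c) + (- c + - b)   ≡⟨ +-assoc a c _ ⟩
      a + (c + (- c + - b))   ≡⟨ cong (a +_) (sym (+-assoc c (- c) (- b))) ⟩
      a + ((c + - c) + - b)   ≡⟨ cong (λ z → a + (z + - b)) (-‿inverseʳ c) ⟩
      a + (0# + - b)          ≡⟨ cong (a +_) (+-identityˡ (- b)) ⟩
      a + - b                 ∎
      where open ≡-Reasoning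

    ⊖-homo : ∀ m n → ⟦ m ℤ.⊖ n ⟧ᶻ ≡ m ·1 + - (n ·1)
    ⊖-homo zero zero = trans (sym (+-identityʳ 0#)) (cong (0# +_) (sym RingProps.-0#≈0#))
    ⊖-homo (suc m) zero = trans (sym (+-identityʳ _)) (cong (suc m ·1 +_) (sym RingProps.-0#≈0#))
    ⊖-homo zero (suc n) = sym (+-identityˡ _)
    ⊖-homo (suc m) (suc n) = trans (cong ⟦_⟧ᶻ (ℤP.[1+m]⊖[1+n]≡m⊖n m n))
                              (trans (⊖-homo m n) (sym (trans (cong₂ (λ a b → a + - b) (·1-suc m) (·1-suc n)) (cancel-left 1# (m ·1) (n ·1)))))

    ◃-homo : ∀ s n → ⟦ s ℤ.◃ n ⟧ᶻ ≡ signed s (n ·1)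
    ◃-homo Sign.+ zero = refl
    ◃-homo Sign.- zero = sym RingProps.-0#≈0#
    ◃-homo Sign.+ (suc n) = refl
    ◃-homo Sign.- (suc n) = refl

    ⟦⟧-signed : ∀ i → ⟦ i ⟧ᶻ ≡ signed (ℤ.sign i) (ℤ.∣ i ∣ ·1)
    ⟦⟧-signed (ℤ.+ n) = refl
    ⟦⟧-signed ℤ.-[1+ n ] = refl

    signed-* : ∀ s t x y → signed (s Sign.* t) (x * y) ≡ signed s x * signed t y
    signed-* Sign.+ Sign.+ x y = refl
    signed-* Sign.+ Sign.- x y = RingProps.-‿distribʳ-* x y
    signed-* Sign.- Sign.+ x y = RingProps.-‿distribˡ-* x y
    signed-* Sign.- Sign.- x y = trans (sym (RingProps.-‿involutive (x * y)))
      (trans (cong -_ (RingProps.-‿distribʳ-* x y)) (RingProps.-‿distribˡ-* x (- y)))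

    +-homo : ∀ i j → ⟦ i ℤ.+ j ⟧ᶻ ≡ ⟦ i ⟧ᶻ + ⟦ j ⟧ᶻ
    +-homo (ℤ.+ m) (ℤ.+ n) = ·1-+ m n
    +-homo (ℤ.+ m) ℤ.-[1+ n ] = ⊖-homo m (suc n)
    +-homo ℤ.-[1+ m ] (ℤ.+ n) = trans (⊖-homo n (suc m)) (+-comm _ _)
    +-homo ℤ.-[1+ m ] ℤ.-[1+ n ] =
      trans (cong (λ z → - (suc z ·1)) (sym (ℕP.+-suc m n)))
            (trans (cong -_ (·1-+ (suc m) (suc n))) (-‿+ _ _))
      where import Data.Nat.Properties as ℕP

    *-homo : ∀ i j → ⟦ i ℤ.* j ⟧ᶻ ≡ ⟦ i ⟧ᶻ * ⟦ j ⟧ᶻ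
    *-homo i j = begin
      ⟦ i ℤ.* j ⟧ᶻ
        ≡⟨ ◃-homo (ℤ.sign i Sign.* ℤ.sign j) (ℤ.∣ i ∣ ℕ.* ℤ.∣ j ∣) ⟩
      signed (ℤ.sign i Sign.* ℤ.sign j) ((ℤ.∣ i ∣ ℕ.* ℤ.∣ j ∣) ·1)
        ≡⟨ cong (signed (ℤ.sign i Sign.* ℤ.sign j)) (·1-* ℤ.∣ i ∣ ℤ.∣ j ∣) ⟩
      signed (ℤ.sign i Sign.* ℤ.sign j) ((ℤ.∣ i ∣ ·1) * (ℤ.∣ j ∣ ·1))
        ≡⟨ signed-* (ℤ.sign i) (ℤ.sign j) _ _ ⟩
      signed (ℤ.sign i) (ℤ.∣ i ∣ ·1) * signed (ℤ.sign j) (ℤ.∣ j ∣ ·1)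
        ≡⟨ sym (cong₂ _*_ (⟦⟧-signed i) (⟦⟧-signed j)) ⟩
      ⟦ i ⟧ᶻ * ⟦ j ⟧ᶻ ∎
      where open ≡-Reasoning

    -‿homo : ∀ i → ⟦ ℤ.- i ⟧ᶻ ≡ - ⟦ i ⟧ᶻ
    -‿homo (ℤ.+ zero) = sym RingProps.-0#≈0#
    -‿homo (ℤ.+ suc n) = refl
    -‿homo ℤ.-[1+ n ] = sym (RingProps.-‿involutive _)

  integerMorphism : ℤ.+-*-rawRing -Raw-AlmostCommutative⟶ fromCommutativeRing commutativeRing
  integerMorphism = record
    { ⟦_⟧ = ⟦_⟧ᶻ ; +-homo = +-homo ; *-homo = *-homo ; -‿homo = -‿homo
    ; 0-homo = refl ; 1-homo = refl }

  private
    coefficient≟ : WeaklyDecidable (Induced-equivalence integerMorphism)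
    coefficient≟ i j with i ℤ.≟ j
    ... | yes refl = just refl
    ... | no _ = nothing

  open import Algebra.Solver.Ring ℤ.+-*-rawRing (fromCommutativeRing commutativeRing) integerMorphism coefficient≟ public
    using (Polynomial; solve; _:=_; _:+_; _:*_; :-_; _:-_; con)

module QuarterArithmetic where
  open import Data.Nat using (_+_; _*_; _∸_; _/_; _%_; _^_)
  import Data.Nat.Properties as ℕP
  open import Data.Nat.DivMod using (m*n/n≡m; m≡m%n+[m/n]*n; %-distribˡ-*)
  open import Data.Nat.Tactic.RingSolver using (solve)
  open import Data.List using (_∷_; [])
  open import Relation.Binary.PropositionalEquality
  open ≡-Reasoning

  exact-quotient : ∀ {x} t n .{{_ : ℕ.NonZero n}} → x ≡ t * n → x / n ≡ t
  exact-quotient t n x≡tn = trans (cong (_/ n) x≡tn) (m*n/n≡m t n)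

  odd-power : ∀ p s → p % 2 ≡ 1 → (p ^ s) % 2 ≡ 1
  odd-power p zero _ = refl
  odd-power p (suc s) p-odd = trans (%-distribˡ-* p (p ^ s) 2) (cong₂ (λ a b → (a * b) % 2) p-odd (odd-power p s p-odd))

  half : ∀ q → q % 2 ≡ 1 → q ≡ suc ((q / 2) + (q / 2))
  half q q-odd = begin
    q                        ≡⟨ m≡m%n+[m/n]*n q 2 ⟩
    q % 2 + (q / 2) * 2      ≡⟨ cong (_+ (q / 2) * 2) q-odd ⟩
    1 + (q / 2) * 2          ≡⟨ cong suc (times-two (q / 2)) ⟩
    suc ((q / 2) + (q / 2))  ∎
    where
    times-two : ∀ t → t * 2 ≡ t + t
    times-two t = solve (t ∷ [])

  half-pred : ∀ q k → q ≡ suc (k + k) → (q ∸ 1) / 2 ≡ k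
  half-pred q k q≡2k+1 = exact-quotient k 2 (trans (cong (_∸ 1) q≡2k+1) (twice k))
    where
    twice : ∀ t → t + t ≡ t * 2
    twice t = solve (t ∷ [])

  private
    double-injective : ∀ k m → k + k ≡ m + m → k ≡ m
    double-injective k m e = ℕP.*-cancelˡ-≡ k m 2 (trans (double k) (trans e (sym (double m))))
      where
      double : ∀ n → 2 * n ≡ n + n
      double n = solve (n ∷ [])

    quarter : ∀ q → q ≡ q % 4 + (q / 4 + q / 4) + (q / 4 + q / 4)
    quarter q = trans (m≡m%n+[m/n]*n q 4) (trans (cong (q % 4 +_) (times-four (q / 4))) (sym (ℕP.+-assoc (q % 4) _ _)))
      where
      times-four : ∀ t → t * 4 ≡ (t + t) + (t + t)
      times-four t = solve (t ∷ [])

  k-even : ∀ q k → q ≡ suc (k + k) → q % 4 ≡ 1 → k ≡ q / 4 + q / 4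
  k-even q k q≡2k+1 q%4≡1 = double-injective k (q / 4 + q / 4) (ℕP.suc-injective (begin
    suc (k + k)                                  ≡⟨ sym q≡2k+1 ⟩
    q                                            ≡⟨ quarter q ⟩
    q % 4 + (q / 4 + q / 4) + (q / 4 + q / 4)    ≡⟨ cong (λ r → r + (q / 4 + q / 4) + (q / 4 + q / 4)) q%4≡1 ⟩
    suc ((q / 4 + q / 4) + (q / 4 + q / 4))      ∎))

  k-odd : ∀ q k → q ≡ suc (k + k) → q % 4 ≡ 3 → k ≡ suc (q / 4 + q / 4)
  k-odd q k q≡2k+1 q%4≡3 = double-injective k (suc (q / 4 + q / 4)) (ℕP.suc-injective (begin
    suc (k + k)                                  ≡⟨ sym q≡2k+1 ⟩
    q                                            ≡⟨ quarter q ⟩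
    q % 4 + (q / 4 + q / 4) + (q / 4 + q / 4)    ≡⟨ cong (λ r → r + (q / 4 + q / 4) + (q / 4 + q / 4)) q%4≡3 ⟩
    3 + (q / 4 + q / 4) + (q / 4 + q / 4)        ≡⟨ regroup (q / 4) ⟩
    suc (suc (q / 4 + q / 4) + suc (q / 4 + q / 4)) ∎))
    where
    regroup : ∀ t → 3 + (t + t) + (t + t) ≡ suc (suc (t + t) + suc (t + t))
    regroup t = solve (t ∷ [])

  module OneModFour (m : ℕ) {q : ℕ} (q≡4m+1 : q ≡ suc ((m + m) + (m + m))) where

    [q+3]/4 : (q + 3) / 4 ≡ suc m
    [q+3]/4 = exact-quotient (suc m) 4 (trans (cong (_+ 3) q≡4m+1) (solve (m ∷ [])))

    [q-3]/2 : (q ∸ 3) / 2 ≡ ℕ.pred (m + m)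
    [q-3]/2 = trans (cong (λ n → (n ∸ 3) / 2) q≡4m+1) (go m)
      where
      go : ∀ m → (suc ((m + m) + (m + m)) ∸ 3) / 2 ≡ ℕ.pred (m + m)
      go zero = refl
      go (suc m) = exact-quotient (m + suc m) 2 (trans (cong (_∸ 3) (arith m)) (ℕP.m+n∸m≡n 3 ((m + suc m) * 2)))
        where
        arith : ∀ m → suc ((suc m + suc m) + (suc m + suc m)) ≡ 3 + (m + suc m) * 2
        arith m = solve (m ∷ [])

  module ThreeModFour (m : ℕ) {q : ℕ} (q≡4m+3 : q ≡ suc (suc (m + m) + suc (m + m))) where

    private
      q-3 : q ∸ 3 ≡ (m + m) * 2
      q-3 = trans (cong (_∸ 3) (trans q≡4m+3 (arith m))) (ℕP.m+n∸m≡n 3 ((m + m) * 2))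
        where
        arith : ∀ m → suc (suc (m + m) + suc (m + m)) ≡ 3 + (m + m) * 2
        arith m = solve (m ∷ [])

    [q+5]/4 : (q + 5) / 4 ≡ suc (suc m)
    [q+5]/4 = exact-quotient (suc (suc m)) 4 (trans (cong (_+ 5) q≡4m+3) (solve (m ∷ [])))

    [q-3]/2 : (q ∸ 3) / 2 ≡ m + m
    [q-3]/2 = exact-quotient (m + m) 2 q-3

    [q-3]/4 : (q ∸ 3) / 4 ≡ m
    [q-3]/4 = exact-quotient m 4 (trans q-3 (arith m))
      where
      arith : ∀ m → (m + m) * 2 ≡ m * 4
      arith m = solve (m ∷ [])

    [q+3]/2 : (q + 3) / 2 ≡ suc (suc (suc (m + m)))
    [q+3]/2 = exact-quotient (suc (suc (suc (m + m)))) 2 (trans (cong (_+ 3) q≡4m+3) (solve (m ∷ [])))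

module FieldFacts {q : ℕ} (F : FiniteField q) where
  open import Data.Nat using (_≤_; z≤n; s≤s)

  import Data.Nat.Properties as ℕP
  open import Data.Fin as Fin using (Fin; zero; suc)
  import Data.Fin.Properties as FinP
  open import Data.List using (List; []; _∷_; length)
  open import Data.Product using (_,_; proj₁; proj₂)
  open import Data.Sum using (_⊎_; inj₁; inj₂)
  open import Data.Empty using (⊥-elim)
  import Data.Integer as ℤ
  open import Relation.Nullary using (¬_; yes; no)
  open import Relation.Nullary.Decidable using (¬?)
  open import Relation.Binary.PropositionalEquality
  open ≡-Reasoning
  open import Algebra.Bundles using (CommutativeRing)
  import Algebra.Properties.Ring as RingProperties
  open import Function.Bundles using (Inverse)

  open FiniteField F public using (Carrier; _+_; _*_; -_; 0#; 1#; _≟_; 0≢1)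
  open FiniteField F using (isCommutativeRing; inverse; enum)
  open FF F public using (_-_; _^ᶠ_; two)

  open IntegerSolver isCommutativeRing public using (Polynomial; solve; _:=_; _:+_; _:*_; :-_; _:-_; con)
  open IntegerSolver isCommutativeRing using (commutativeRing)
  open CommutativeRing commutativeRing public
    using ( +-assoc; +-comm; +-identityˡ; +-identityʳ; -‿inverseʳ
          ; *-assoc; *-comm; *-identityˡ; *-identityʳ; zeroˡ; zeroʳ; distribʳ)
  open CommutativeRing commutativeRing using (ring; +-commutativeMonoid; *-commutativeMonoid)
  module RingProps = RingProperties ring

  open Counting
  open FiniteSum enum public
  open Points _≟_ public
  open Inverse enum public using (to; from) renaming (strictlyInverseˡ to to-from)

  :0 :1 :2 : ∀ {n} → Polynomial n
  :0 = con (ℤ.+ 0)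
  :1 = con (ℤ.+ 1)
  :2 = con (ℤ.+ 2)

  1≢0 : ¬ 1# ≡ 0#
  1≢0 e = 0≢1 (sym e)

  inv : (a : Carrier) → ¬ a ≡ 0# → Carrier
  inv a a≢0 = proj₁ (inverse a a≢0)

  inv-r : ∀ a (a≢0 : ¬ a ≡ 0#) → a * inv a a≢0 ≡ 1#
  inv-r a a≢0 = proj₂ (inverse a a≢0)

  inv-l : ∀ a (a≢0 : ¬ a ≡ 0#) → inv a a≢0 * a ≡ 1#
  inv-l a a≢0 = trans (*-comm _ _) (inv-r a a≢0)

  *-cancelˡ : ∀ a {x y} → ¬ a ≡ 0# → a * x ≡ a * y → x ≡ y
  *-cancelˡ a {x} {y} a≢0 e = begin
    x                  ≡⟨ sym (*-identityˡ x) ⟩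
    1# * x             ≡⟨ cong (_* x) (sym (inv-l a a≢0)) ⟩
    (inv a a≢0 * a) * x ≡⟨ *-assoc _ _ _ ⟩
    inv a a≢0 * (a * x) ≡⟨ cong (inv a a≢0 *_) e ⟩
    inv a a≢0 * (a * y) ≡⟨ sym (*-assoc _ _ _) ⟩
    (inv a a≢0 * a) * y ≡⟨ cong (_* y) (inv-l a a≢0) ⟩
    1# * y             ≡⟨ *-identityˡ y ⟩
    y                  ∎

  no-zero-divisors : ∀ a b → a * b ≡ 0# → a ≡ 0# ⊎ b ≡ 0#
  no-zero-divisors a b ab≡0 with a ≟ 0#
  ... | yes a≡0 = inj₁ a≡0
  ... | no a≢0 = inj₂ (*-cancelˡ a a≢0 (trans ab≡0 (sym (zeroʳ a))))

  *-nonzero : ∀ a b → ¬ a ≡ 0# → ¬ b ≡ 0# → ¬ a * b ≡ 0#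
  *-nonzero a b a≢0 b≢0 ab≡0 with no-zero-divisors a b ab≡0
  ... | inj₁ a≡0 = a≢0 a≡0
  ... | inj₂ b≡0 = b≢0 b≡0

  square≡0 : ∀ b → b * b ≡ 0# → b ≡ 0#
  square≡0 b bb≡0 with no-zero-divisors b b bb≡0
  ... | inj₁ b≡0 = b≡0
  ... | inj₂ b≡0 = b≡0

  -≡0⇒≡ : ∀ a b → a - b ≡ 0# → a ≡ b
  -≡0⇒≡ a b a-b≡0 = begin
    a             ≡⟨ solve 2 (λ a b → a := (a :- b) :+ b) refl a b ⟩
    (a - b) + b   ≡⟨ cong (_+ b) a-b≡0 ⟩
    0# + b        ≡⟨ +-identityˡ b ⟩
    b             ∎

  -‿≢0 : ∀ a → ¬ a ≡ 0# → ¬ - a ≡ 0#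
  -‿≢0 a a≢0 -a≡0 = a≢0 (trans (sym (RingProps.-‿involutive a)) (trans (cong -_ -a≡0) RingProps.-0#≈0#))

  equal-squares : ∀ x y → x * x ≡ y * y → x ≡ y ⊎ x ≡ - y
  equal-squares x y xx≡yy with no-zero-divisors (x - y) (x + y) factored
    where
    factored : (x - y) * (x + y) ≡ 0#
    factored = begin
      (x - y) * (x + y) ≡⟨ solve 2 (λ x y → (x :- y) :* (x :+ y) := x :* x :- y :* y) refl x y ⟩
      x * x - y * y     ≡⟨ cong (_- y * y) xx≡yy ⟩
      y * y - y * y     ≡⟨ -‿inverseʳ (y * y) ⟩
      0#                ∎
  ... | inj₁ x-y≡0 = inj₁ (-≡0⇒≡ x y x-y≡0)
  ... | inj₂ x+y≡0 = inj₂ (-≡0⇒≡ x (- y) (trans (solve 2 (λ x y → x :- (:- y) := x :+ y) refl x y) x+y≡0))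

  ^-+ : ∀ x m n → x ^ᶠ (m ℕ.+ n) ≡ x ^ᶠ m * x ^ᶠ n
  ^-+ x zero n = sym (*-identityˡ _)
  ^-+ x (suc m) n = trans (cong (x *_) (^-+ x m n)) (sym (*-assoc _ _ _))

  ^-distrib-* : ∀ x y n → (x * y) ^ᶠ n ≡ x ^ᶠ n * y ^ᶠ n
  ^-distrib-* x y zero = sym (*-identityˡ 1#)
  ^-distrib-* x y (suc n) = trans (cong ((x * y) *_) (^-distrib-* x y n))
    (solve 4 (λ x y a b → (x :* y) :* (a :* b) := (x :* a) :* (y :* b)) refl x y (x ^ᶠ n) (y ^ᶠ n))

  -- Sums in the additive group of F: q · 1 = 0, because translating by 1 permutes F.
  module Additive = InMonoid +-commutativeMonoid
  open Additive using (⨁; _×_)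

  q·1≡0 : q × 1# ≡ 0#
  q·1≡0 = begin
    q × 1#               ≡⟨ solve 2 (λ S T → T := (S :+ T) :- S) refl S (q × 1#) ⟩
    (S + q × 1#) - S     ≡⟨ cong (_- S) (sym translation-invariance) ⟩
    S - S                ≡⟨ -‿inverseʳ S ⟩
    0#                   ∎
    where
    S = ⨁ (λ x → x)
    translation-invariance : S ≡ S + q × 1#
    translation-invariance = begin
      S                       ≡⟨ Additive.⨁-reindex (_+ 1#) (_- 1#)
                                   (λ x → solve 1 (λ x → (x :- :1) :+ :1 := x) refl x)
                                   (λ x → solve 1 (λ x → (x :+ :1) :- :1 := x) refl x) (λ x → x) ⟩
      ⨁ (λ x → x + 1#)        ≡⟨ Additive.∑-distrib-+ (λ i → to i) (λ _ → 1#) ⟩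
      S + ⨁ (λ _ → 1#)        ≡⟨ cong (S +_) (Additive.⨁-const 1#) ⟩
      S + q × 1#              ∎

  two≢0 : ∀ k → q ≡ suc (k ℕ.+ k) → ¬ two ≡ 0#
  two≢0 k q≡2k+1 two≡0 = 1≢0 (trans (sym (odd-multiple k)) (trans (cong (_× 1#) (sym q≡2k+1)) q·1≡0))
    where
    odd-multiple : ∀ m → suc (m ℕ.+ m) × 1# ≡ 1#
    odd-multiple zero = +-identityʳ 1#
    odd-multiple (suc m) = begin
      1# + (suc m ℕ.+ suc m) × 1#     ≡⟨ cong (λ n → 1# + n × 1#) (ℕP.+-suc (suc m) m) ⟩
      1# + (1# + suc (m ℕ.+ m) × 1#)  ≡⟨ cong (λ z → 1# + (1# + z)) (odd-multiple m) ⟩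
      1# + (1# + 1#)                  ≡⟨ sym (+-assoc 1# 1# 1#) ⟩
      two + 1#                        ≡⟨ cong (_+ 1#) two≡0 ⟩
      0# + 1#                         ≡⟨ +-identityˡ 1# ⟩
      1#                              ∎

  nonzero-count : ∀ {n} → q ≡ suc n → Σ (λ x → 𝟙 (¬? (x ≟ 0#))) ≡ n
  nonzero-count {n} q≡1+n = ℕP.suc-injective (begin
    suc (Σ (λ x → 𝟙 (¬? (x ≟ 0#))))                      ≡⟨ cong (ℕ._+ Σ (λ x → 𝟙 (¬? (x ≟ 0#)))) (sym (Σ-point1 0#)) ⟩
    Σ (λ x → [ x ≐ 0# ]) ℕ.+ Σ (λ x → 𝟙 (¬? (x ≟ 0#)))   ≡⟨ sym (Σ-+ (λ x → [ x ≐ 0# ]) (λ x → 𝟙 (¬? (x ≟ 0#)))) ⟩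
    Σ (λ x → [ x ≐ 0# ] ℕ.+ 𝟙 (¬? (x ≟ 0#)))             ≡⟨ Σ-cong (λ x → 𝟙-complement (x ≟ 0#)) ⟩
    Σ (λ _ → 1)                                          ≡⟨ Σ-const 1 ⟩
    q ℕ.* 1                                              ≡⟨ ℕP.*-identityʳ q ⟩
    q                                                    ≡⟨ q≡1+n ⟩
    suc n                                                ∎)

  module Multiplicative = InMonoid *-commutativeMonoid
  open Multiplicative using () renaming (⨁ to Π)

  unit-part : Carrier → Carrier
  unit-part x with x ≟ 0#
  ... | yes _ = 1#
  ... | no _ = x

  -- The factor by which unit-part x changes when x is scaled by a.
  scaling : Carrier → Carrier → Carrier
  scaling a x with x ≟ 0#
  ... | yes _ = 1#
  ... | no _ = a

  unit-part-scaled : ∀ a → ¬ a ≡ 0# → ∀ x → unit-part (a * x) ≡ scaling a x * unit-part x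
  unit-part-scaled a a≢0 x with x ≟ 0# | (a * x) ≟ 0#
  ... | yes _ | yes _ = sym (*-identityˡ 1#)
  ... | yes x≡0 | no ax≢0 = ⊥-elim (ax≢0 (trans (cong (a *_) x≡0) (zeroʳ a)))
  ... | no x≢0 | yes ax≡0 = ⊥-elim (*-nonzero a x a≢0 x≢0 ax≡0)
  ... | no _ | no _ = refl

  Π-scaling : ∀ a → Π (scaling a) ≡ a ^ᶠ Σ (λ x → 𝟙 (¬? (x ≟ 0#)))
  Π-scaling a = go q to
    where
    module NatSum = InMonoid ℕP.+-0-commutativeMonoid
    go : ∀ m (h : Fin m → Carrier) →
         Multiplicative.sum (λ i → scaling a (h i)) ≡ a ^ᶠ NatSum.sum (λ i → 𝟙 (¬? (h i ≟ 0#)))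
    go zero h = refl
    go (suc m) h with h zero ≟ 0#
    ... | yes _ = trans (*-identityˡ _) (go m (λ i → h (suc i)))
    ... | no _ = cong (a *_) (go m (λ i → h (suc i)))

  Π-unit-part≢0 : ¬ Π unit-part ≡ 0#
  Π-unit-part≢0 = go q to
    where
    unit-part≢0 : ∀ x → ¬ unit-part x ≡ 0#
    unit-part≢0 x with x ≟ 0#
    ... | yes _ = 1≢0
    ... | no x≢0 = x≢0
    go : ∀ m (h : Fin m → Carrier) → ¬ Multiplicative.sum (λ i → unit-part (h i)) ≡ 0#
    go zero h = 1≢0
    go (suc m) h = *-nonzero _ _ (unit-part≢0 (h zero)) (go m (λ i → h (suc i)))

  -- Fermat's little theorem: a^(q-1) = 1 for a ≠ 0, since x ↦ a x permutes F.
  fermat : ∀ {n} → q ≡ suc n → ∀ a → ¬ a ≡ 0# → a ^ᶠ n ≡ 1#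
  fermat {n} q≡1+n a a≢0 =
    *-cancelˡ (Π unit-part) Π-unit-part≢0 (trans (*-comm _ _) (trans (sym scaled) (sym (*-identityʳ _))))
    where
    a⁻¹ = inv a a≢0
    scaled : Π unit-part ≡ a ^ᶠ n * Π unit-part
    scaled = begin
      Π unit-part
        ≡⟨ Multiplicative.⨁-reindex (a *_) (a⁻¹ *_)
             (λ x → trans (sym (*-assoc a a⁻¹ x)) (trans (cong (_* x) (inv-r a a≢0)) (*-identityˡ x)))
             (λ x → trans (sym (*-assoc a⁻¹ a x)) (trans (cong (_* x) (inv-l a a≢0)) (*-identityˡ x))) unit-part ⟩
      Π (λ x → unit-part (a * x))
        ≡⟨ Multiplicative.sum-cong-≗ (λ i → unit-part-scaled a a≢0 (to i)) ⟩
      Π (λ x → scaling a x * unit-part x)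
        ≡⟨ Multiplicative.∑-distrib-+ (λ i → scaling a (to i)) (λ i → unit-part (to i)) ⟩
      Π (scaling a) * Π unit-part
        ≡⟨ cong (_* Π unit-part) (trans (Π-scaling a) (cong (a ^ᶠ_) (nonzero-count q≡1+n))) ⟩
      a ^ᶠ n * Π unit-part ∎

  -- Monic polynomials: a₀ ∷ … ∷ aₙ₋₁ stands for a₀ + a₁ x + … + aₙ₋₁ xⁿ⁻¹ + xⁿ.
  MonicPoly : Set
  MonicPoly = List Carrier

  eval : MonicPoly → Carrier → Carrier
  eval [] x = 1#
  eval (a ∷ p) x = a + x * eval p x

  -- The quotient of p by x - r (synthetic division).
  quotient : Carrier → MonicPoly → MonicPoly
  quotient r [] = []
  quotient r (a ∷ []) = []
  quotient r (a ∷ b ∷ p) = eval (b ∷ p) r ∷ quotient r (b ∷ p)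

  quotient-length : ∀ r a p → length (quotient r (a ∷ p)) ≡ length p
  quotient-length r a [] = refl
  quotient-length r a (b ∷ p) = cong suc (quotient-length r b p)

  remainder-theorem : ∀ r a p x → eval (a ∷ p) x ≡ (x - r) * eval (quotient r (a ∷ p)) x + eval (a ∷ p) r
  remainder-theorem r a [] x =
    solve 3 (λ a x r → a :+ x :* :1 := (x :- r) :* :1 :+ (a :+ r :* :1)) refl a x r
  remainder-theorem r a (b ∷ p) x = trans (cong (λ z → a + x * z) (remainder-theorem r b p x))
    (solve 5 (λ a x r Q P → a :+ x :* ((x :- r) :* Q :+ P) := (x :- r) :* (P :+ x :* Q) :+ (a :+ r :* P)) refl
       a x r (eval (quotient r (b ∷ p)) x) (eval (b ∷ p) r))

  roots : MonicPoly → ℕ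
  roots p = Σ (λ x → [ eval p x ≐ 0# ])

  root-bound : ∀ n (p : MonicPoly) → length p ≡ n → roots p ≤ n
  root-bound zero [] _ = ℕP.≤-reflexive (Σ-zero _ (λ x → 𝟙-no (1# ≟ 0#) 1≢0))
  root-bound (suc n) (a ∷ p) len with FinP.any? (λ i → eval (a ∷ p) (to i) ≟ 0#)
  ... | no no-root = ℕP.≤-trans (ℕP.≤-reflexive (Σ-zero _ (λ x → 𝟙-no (eval (a ∷ p) x ≟ 0#) (not-root x)))) z≤n
    where
    not-root : ∀ x → ¬ eval (a ∷ p) x ≡ 0#
    not-root x px≡0 = no-root (from x , trans (cong (eval (a ∷ p)) (to-from x)) px≡0)
  ... | yes (i , pr≡0) =
    ℕP.≤-trans (Σ-mono _ (λ x → [ x ≐ r ] ℕ.+ [ eval Q x ≐ 0# ]) root-of-factor)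
      (ℕP.≤-trans (ℕP.≤-reflexive split) (s≤s (root-bound n Q (trans (quotient-length r a p) (ℕP.suc-injective len)))))
    where
    r = to i
    Q = quotient r (a ∷ p)
    split : Σ (λ x → [ x ≐ r ] ℕ.+ [ eval Q x ≐ 0# ]) ≡ suc (roots Q)
    split = trans (Σ-+ (λ x → [ x ≐ r ]) (λ x → [ eval Q x ≐ 0# ])) (cong (ℕ._+ roots Q) (Σ-point1 r))
    root-of-factor : ∀ x → [ eval (a ∷ p) x ≐ 0# ] ≤ [ x ≐ r ] ℕ.+ [ eval Q x ≐ 0# ]
    root-of-factor x with eval (a ∷ p) x ≟ 0#
    ... | no _ = z≤n
    ... | yes px≡0 with no-zero-divisors (x - r) (eval Q x) factored
      where
      factored : (x - r) * eval Q x ≡ 0#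
      factored = trans (sym (+-identityʳ _)) (trans (cong ((x - r) * eval Q x +_) (sym pr≡0))
                   (trans (sym (remainder-theorem r a p x)) px≡0))
    ...   | inj₁ x-r≡0 = ℕP.≤-trans (ℕP.≤-reflexive (sym (𝟙-yes (x ≟ r) (-≡0⇒≡ x r x-r≡0)))) (ℕP.m≤m+n _ _)
    ...   | inj₂ Qx≡0 = ℕP.≤-trans (ℕP.≤-reflexive (sym (𝟙-yes (eval Q x ≟ 0#) Qx≡0))) (ℕP.m≤n+m _ _)

module QuadraticCharacter {q : ℕ} (F : FiniteField q) (k : ℕ) (q≡2k+1 : q ≡ suc (k ℕ.+ k)) where
  open import Data.Nat using (_≤_; z≤n)
  open import Relation.Binary.PropositionalEquality

  import Data.Nat.Properties as ℕP
  import Data.Fin.Properties as FinP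
  open import Data.Fin using (Fin; zero)
  open import Data.List using (_∷_; []; replicate)
  open import Data.Nat.Tactic.RingSolver using () renaming (solve to ℕ-solve)
  open import Data.List.Properties using (length-replicate)
  open import Data.Product using (_,_; proj₁; proj₂)
  open import Data.Sum using (_⊎_; inj₁; inj₂)
  open import Data.Empty using (⊥-elim)
  open import Relation.Nullary using (¬_; Dec; yes; no)
  open import Relation.Nullary.Decidable using (¬?; _×-dec_)
  open ≡-Reasoning

  open Counting
  open FieldFacts F
  open FF F using (IsSquare; C₀; C₁)

  two-nonzero : ¬ two ≡ 0#
  two-nonzero = two≢0 k q≡2k+1

  ≡-⇒≡0 : ∀ a → a ≡ - a → a ≡ 0#
  ≡-⇒≡0 a a≡-a with no-zero-divisors two a two-a≡0
    where
    two-a≡0 : two * a ≡ 0#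
    two-a≡0 = trans (solve 1 (λ a → :2 :* a := a :+ a) refl a) (trans (cong (a +_) a≡-a) (-‿inverseʳ a))
  ... | inj₁ two≡0 = ⊥-elim (two-nonzero two≡0)
  ... | inj₂ a≡0 = a≡0

  1≢-1 : ¬ 1# ≡ - 1#
  1≢-1 e = 1≢0 (≡-⇒≡0 1# e)

  IsSquare? : ∀ a → Dec (IsSquare a)
  IsSquare? a with FinP.any? (λ i → (to i * to i) ≟ a)
  ... | yes (i , e) = yes (to i , e)
  ... | no none = no (λ { (b , bb≡a) → none (from b , trans (cong (λ z → z * z) (to-from b)) bb≡a) })

  C₀? : ∀ a → Dec (C₀ a)
  C₀? a = ¬? (a ≟ 0#) ×-dec IsSquare? a

  C₁? : ∀ a → Dec (C₁ a)
  C₁? a = ¬? (a ≟ 0#) ×-dec ¬? (IsSquare? a)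

  classify : ∀ x → x ≡ 0# ⊎ C₀ x ⊎ C₁ x
  classify x with x ≟ 0# | IsSquare? x
  ... | yes x≡0 | _ = inj₁ x≡0
  ... | no x≢0 | yes sq = inj₂ (inj₁ (x≢0 , sq))
  ... | no x≢0 | no nsq = inj₂ (inj₂ (x≢0 , nsq))

  trichotomy : ∀ x → [ x ≐ 0# ] ℕ.+ (𝟙 (C₀? x) ℕ.+ 𝟙 (C₁? x)) ≡ 1
  trichotomy x with classify x
  ... | inj₁ x≡0 = cong₂ ℕ._+_ (𝟙-yes (x ≟ 0#) x≡0)
                     (cong₂ ℕ._+_ (𝟙-no (C₀? x) (λ c → proj₁ c x≡0)) (𝟙-no (C₁? x) (λ c → proj₁ c x≡0)))
  ... | inj₂ (inj₁ c₀) = cong₂ ℕ._+_ (𝟙-no (x ≟ 0#) (proj₁ c₀))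
                     (cong₂ ℕ._+_ (𝟙-yes (C₀? x) c₀) (𝟙-no (C₁? x) (λ c₁ → proj₂ c₁ (proj₂ c₀))))
  ... | inj₂ (inj₂ c₁) = cong₂ ℕ._+_ (𝟙-no (x ≟ 0#) (proj₁ c₁))
                     (cong₂ ℕ._+_ (𝟙-no (C₀? x) (λ c₀ → proj₂ c₁ (proj₂ c₀))) (𝟙-yes (C₁? x) c₁))

  C₀C₁-complement : ∀ x → ¬ x ≡ 0# → 𝟙 (C₀? x) ℕ.+ 𝟙 (C₁? x) ≡ 1
  C₀C₁-complement x x≢0 = trans (cong (ℕ._+ (𝟙 (C₀? x) ℕ.+ 𝟙 (C₁? x))) (sym (𝟙-no (x ≟ 0#) x≢0))) (trichotomy x)

  Σ-by-class : ∀ g → Σ g ≡ g 0# ℕ.+ (Σ (λ x → 𝟙 (C₀? x) ℕ.* g x) ℕ.+ Σ (λ x → 𝟙 (C₁? x) ℕ.* g x))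
  Σ-by-class g = begin
    Σ g
      ≡⟨ Σ-cong (λ x → sym (trans (cong (ℕ._* g x) (trichotomy x)) (ℕP.*-identityˡ (g x)))) ⟩
    Σ (λ x → ([ x ≐ 0# ] ℕ.+ (𝟙 (C₀? x) ℕ.+ 𝟙 (C₁? x))) ℕ.* g x)
      ≡⟨ Σ-cong (λ x → distribute [ x ≐ 0# ] (𝟙 (C₀? x)) (𝟙 (C₁? x)) (g x)) ⟩
    Σ (λ x → [ x ≐ 0# ] ℕ.* g x ℕ.+ (𝟙 (C₀? x) ℕ.* g x ℕ.+ 𝟙 (C₁? x) ℕ.* g x))
      ≡⟨ Σ-+ (λ x → [ x ≐ 0# ] ℕ.* g x) (λ x → 𝟙 (C₀? x) ℕ.* g x ℕ.+ 𝟙 (C₁? x) ℕ.* g x) ⟩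
    Σ (λ x → [ x ≐ 0# ] ℕ.* g x) ℕ.+ Σ (λ x → 𝟙 (C₀? x) ℕ.* g x ℕ.+ 𝟙 (C₁? x) ℕ.* g x)
      ≡⟨ cong₂ ℕ._+_ (Σ-point 0# g) (Σ-+ (λ x → 𝟙 (C₀? x) ℕ.* g x) (λ x → 𝟙 (C₁? x) ℕ.* g x)) ⟩
    g 0# ℕ.+ (Σ (λ x → 𝟙 (C₀? x) ℕ.* g x) ℕ.+ Σ (λ x → 𝟙 (C₁? x) ℕ.* g x)) ∎
    where
    distribute : ∀ a b c n → (a ℕ.+ (b ℕ.+ c)) ℕ.* n ≡ a ℕ.* n ℕ.+ (b ℕ.* n ℕ.+ c ℕ.* n)
    distribute a b c n = ℕ-solve (a ∷ b ∷ c ∷ n ∷ [])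

  sqrts : Carrier → ℕ
  sqrts y = Σ (λ b → [ b * b ≐ y ])

  sqrts-value : ∀ y → sqrts y ≡ [ y ≐ 0# ] ℕ.+ 2 ℕ.* 𝟙 (C₀? y)
  sqrts-value y with classify y
  ... | inj₁ y≡0 = begin
    sqrts y                              ≡⟨ Σ-cong (λ b → 𝟙-cong ((b * b) ≟ y) (b ≟ 0#) (λ bb≡y → square≡0 b (trans bb≡y y≡0))
                                              (λ b≡0 → trans (cong (λ z → z * z) b≡0) (trans (zeroˡ 0#) (sym y≡0)))) ⟩
    Σ (λ b → [ b ≐ 0# ])                  ≡⟨ Σ-point1 0# ⟩
    1                                    ≡⟨ sym (cong₂ ℕ._+_ (𝟙-yes (y ≟ 0#) y≡0) (cong (2 ℕ.*_) (𝟙-no (C₀? y) (λ c → proj₁ c y≡0)))) ⟩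
    [ y ≐ 0# ] ℕ.+ 2 ℕ.* 𝟙 (C₀? y)        ∎
  ... | inj₂ (inj₁ c₀@(y≢0 , a , aa≡y)) = begin
    sqrts y                              ≡⟨ Σ-cong two-roots ⟩
    Σ (λ b → [ b ≐ a ] ℕ.+ [ b ≐ - a ])   ≡⟨ Σ-+ (λ b → [ b ≐ a ]) (λ b → [ b ≐ - a ]) ⟩
    Σ (λ b → [ b ≐ a ]) ℕ.+ Σ (λ b → [ b ≐ - a ]) ≡⟨ cong₂ ℕ._+_ (Σ-point1 a) (Σ-point1 (- a)) ⟩
    2                                    ≡⟨ sym (cong₂ ℕ._+_ (𝟙-no (y ≟ 0#) y≢0) (cong (2 ℕ.*_) (𝟙-yes (C₀? y) c₀))) ⟩
    [ y ≐ 0# ] ℕ.+ 2 ℕ.* 𝟙 (C₀? y)        ∎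
    where
    a≢-a : ¬ a ≡ - a
    a≢-a a≡-a = y≢0 (trans (sym aa≡y) (trans (cong (λ z → z * z) (≡-⇒≡0 a a≡-a)) (zeroˡ 0#)))
    -a-squared : (- a) * (- a) ≡ y
    -a-squared = trans (solve 1 (λ a → (:- a) :* (:- a) := a :* a) refl a) aa≡y
    two-roots : ∀ b → [ b * b ≐ y ] ≡ [ b ≐ a ] ℕ.+ [ b ≐ - a ]
    two-roots b with (b * b) ≟ y | b ≟ a | b ≟ (- a)
    ... | _ | yes b≡a | yes b≡-a = ⊥-elim (a≢-a (trans (sym b≡a) b≡-a))
    ... | yes _ | yes _ | no _ = refl
    ... | yes _ | no _ | yes _ = refl
    ... | yes bb≡y | no b≢a | no b≢-a with equal-squares b a (trans bb≡y (sym aa≡y))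
    ...   | inj₁ b≡a = ⊥-elim (b≢a b≡a)
    ...   | inj₂ b≡-a = ⊥-elim (b≢-a b≡-a)
    two-roots b | no bb≢y | yes b≡a | no _ = ⊥-elim (bb≢y (trans (cong (λ z → z * z) b≡a) aa≡y))
    two-roots b | no bb≢y | no _ | yes b≡-a = ⊥-elim (bb≢y (trans (cong (λ z → z * z) b≡-a) -a-squared))
    two-roots b | no _ | no _ | no _ = refl
  ... | inj₂ (inj₂ c₁@(y≢0 , nsq)) = trans (Σ-zero _ (λ b → 𝟙-no ((b * b) ≟ y) (λ bb≡y → nsq (b , bb≡y))))
    (sym (cong₂ ℕ._+_ (𝟙-no (y ≟ 0#) y≢0) (cong (2 ℕ.*_) (𝟙-no (C₀? y) (λ c₀ → nsq (proj₂ c₀))))))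

  -- Each b is a square root of exactly one y, so the counts add up to q.
  Σ-sqrts : Σ sqrts ≡ q
  Σ-sqrts = begin
    Σ (λ y → Σ (λ b → [ b * b ≐ y ]))  ≡⟨ Σ-swap (λ y b → [ b * b ≐ y ]) ⟩
    Σ (λ b → Σ (λ y → [ b * b ≐ y ]))  ≡⟨ Σ-cong (λ b → trans (Σ-cong (≐-sym (b * b))) (Σ-point1 (b * b))) ⟩
    Σ (λ _ → 1)                        ≡⟨ Σ-const 1 ⟩
    q ℕ.* 1                            ≡⟨ ℕP.*-identityʳ q ⟩
    q                                  ∎

  #C₀ : Σ (λ y → 𝟙 (C₀? y)) ≡ k
  #C₀ = ℕP.*-cancelˡ-≡ _ k 2 (ℕP.suc-injective (begin
    suc (2 ℕ.* S)                                   ≡⟨ cong (ℕ._+ 2 ℕ.* S) (sym (Σ-point1 0#)) ⟩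
    Σ (λ y → [ y ≐ 0# ]) ℕ.+ 2 ℕ.* S                 ≡⟨ cong (Σ (λ y → [ y ≐ 0# ]) ℕ.+_) (sym (Σ-*ˡ 2 (λ y → 𝟙 (C₀? y)))) ⟩
    Σ (λ y → [ y ≐ 0# ]) ℕ.+ Σ (λ y → 2 ℕ.* 𝟙 (C₀? y)) ≡⟨ sym (Σ-+ (λ y → [ y ≐ 0# ]) (λ y → 2 ℕ.* 𝟙 (C₀? y))) ⟩
    Σ (λ y → [ y ≐ 0# ] ℕ.+ 2 ℕ.* 𝟙 (C₀? y))          ≡⟨ Σ-cong (λ y → sym (sqrts-value y)) ⟩
    Σ sqrts                                         ≡⟨ Σ-sqrts ⟩
    q                                               ≡⟨ q≡2k+1 ⟩
    suc (k ℕ.+ k)                                   ≡⟨ cong (λ m → suc (k ℕ.+ m)) (sym (ℕP.+-identityʳ k)) ⟩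
    suc (2 ℕ.* k)                                   ∎))
    where S = Σ (λ y → 𝟙 (C₀? y))

  #C₁ : Σ (λ y → 𝟙 (C₁? y)) ≡ k
  #C₁ = ℕP.+-cancelˡ-≡ (suc k) _ k (begin
    suc k ℕ.+ N                                         ≡⟨ cong (λ m → suc (m ℕ.+ N)) (sym #C₀) ⟩
    suc (S ℕ.+ N)                                       ≡⟨ cong (ℕ._+ (S ℕ.+ N)) (sym (Σ-point1 0#)) ⟩
    Σ (λ x → [ x ≐ 0# ]) ℕ.+ (S ℕ.+ N)                   ≡⟨ cong (Σ (λ x → [ x ≐ 0# ]) ℕ.+_) (sym (Σ-+ (λ x → 𝟙 (C₀? x)) (λ x → 𝟙 (C₁? x)))) ⟩
    Σ (λ x → [ x ≐ 0# ]) ℕ.+ Σ (λ x → 𝟙 (C₀? x) ℕ.+ 𝟙 (C₁? x)) ≡⟨ sym (Σ-+ (λ x → [ x ≐ 0# ]) (λ x → 𝟙 (C₀? x) ℕ.+ 𝟙 (C₁? x))) ⟩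
    Σ (λ x → [ x ≐ 0# ] ℕ.+ (𝟙 (C₀? x) ℕ.+ 𝟙 (C₁? x)))   ≡⟨ Σ-cong trichotomy ⟩
    Σ (λ _ → 1)                                         ≡⟨ Σ-const 1 ⟩
    q ℕ.* 1                                             ≡⟨ ℕP.*-identityʳ q ⟩
    q                                                   ≡⟨ q≡2k+1 ⟩
    suc (k ℕ.+ k)                                       ∎)
    where
    S = Σ (λ y → 𝟙 (C₀? y))
    N = Σ (λ y → 𝟙 (C₁? y))

  -- A field has two distinct elements, so q ≠ 1 and k ≥ 1.
  k≡1+pk : k ≡ suc (ℕ.pred k)
  k≡1+pk = positive k q≡2k+1
    where
    singleton : ∀ {n} → n ≡ 1 → (i j : Fin n) → i ≡ j
    singleton refl zero zero = refl
    positive : ∀ m → q ≡ suc (m ℕ.+ m) → m ≡ suc (ℕ.pred m)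
    positive (suc m) _ = refl
    positive zero q≡1 =
      ⊥-elim (0≢1 (trans (sym (to-from 0#)) (trans (cong to (singleton q≡1 (from 0#) (from 1#))) (to-from 1#))))

  χ : Carrier → Carrier
  χ x = x ^ᶠ k

  χ-mul : ∀ a b → χ (a * b) ≡ χ a * χ b
  χ-mul a b = ^-distrib-* a b k

  χ0 : χ 0# ≡ 0#
  χ0 = trans (cong (0# ^ᶠ_) k≡1+pk) (zeroˡ _)

  χ-squared : ∀ x → ¬ x ≡ 0# → χ x * χ x ≡ 1#
  χ-squared x x≢0 = trans (sym (^-+ x k k)) (fermat q≡2k+1 x x≢0)

  χ≡±1 : ∀ x → ¬ x ≡ 0# → χ x ≡ 1# ⊎ χ x ≡ - 1#
  χ≡±1 x x≢0 = equal-squares (χ x) 1# (trans (χ-squared x x≢0) (sym (*-identityˡ 1#)))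

  χ≢0 : ∀ x → ¬ x ≡ 0# → ¬ χ x ≡ 0#
  χ≢0 x x≢0 χx≡0 with χ≡±1 x x≢0
  ... | inj₁ χx≡1 = 1≢0 (trans (sym χx≡1) χx≡0)
  ... | inj₂ χx≡-1 = -‿≢0 1# 1≢0 (trans (sym χx≡-1) χx≡0)

  χ-C₀ : ∀ a → C₀ a → χ a ≡ 1#
  χ-C₀ a (a≢0 , b , bb≡a) = begin
    χ a            ≡⟨ cong χ (sym bb≡a) ⟩
    χ (b * b)      ≡⟨ χ-mul b b ⟩
    χ b * χ b      ≡⟨ χ-squared b b≢0 ⟩
    1#             ∎
    where
    b≢0 : ¬ b ≡ 0#
    b≢0 b≡0 = a≢0 (trans (sym bb≡a) (trans (cong (λ z → z * z) b≡0) (zeroˡ 0#)))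

  -- Euler's criterion: nonsquares have character -1.  Otherwise the monic
  -- polynomial x^k - 1 of degree k would vanish at the k squares and at one more point.
  χ-C₁ : ∀ n → C₁ n → χ n ≡ - 1#
  χ-C₁ n (n≢0 , nsq) with χ≡±1 n n≢0
  ... | inj₂ χn≡-1 = χn≡-1
  ... | inj₁ χn≡1 = ⊥-elim (ℕP.<-irrefl refl (ℕP.≤-trans at-least at-most))
    where
    xᵏ-1 : MonicPoly
    xᵏ-1 = (- 1#) ∷ replicate (ℕ.pred k) 0#
    eval-xᵏ-1 : ∀ x → eval xᵏ-1 x ≡ - 1# + χ x
    eval-xᵏ-1 x = cong (- 1# +_) (trans (cong (x *_) (eval-zeros (ℕ.pred k))) (cong (x ^ᶠ_) (sym k≡1+pk)))
      where
      eval-zeros : ∀ m → eval (replicate m 0#) x ≡ x ^ᶠ m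
      eval-zeros zero = refl
      eval-zeros (suc m) = trans (+-identityˡ _) (cong (x *_) (eval-zeros m))
    root : ∀ x → χ x ≡ 1# → [ eval xᵏ-1 x ≐ 0# ] ≡ 1
    root x χx≡1 = 𝟙-yes (eval xᵏ-1 x ≟ 0#)
      (trans (eval-xᵏ-1 x) (trans (cong (- 1# +_) χx≡1) (trans (+-comm _ _) (-‿inverseʳ 1#))))
    counted : ∀ x → 𝟙 (C₀? x) ℕ.+ [ x ≐ n ] ≤ [ eval xᵏ-1 x ≐ 0# ]
    counted x with C₀? x | x ≟ n
    ... | yes c₀ | yes x≡n = ⊥-elim (nsq (subst IsSquare x≡n (proj₂ c₀)))
    ... | yes c₀ | no _ = ℕP.≤-reflexive (sym (root x (χ-C₀ x c₀)))
    ... | no _ | yes x≡n = ℕP.≤-reflexive (sym (root x (trans (cong χ x≡n) χn≡1)))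
    ... | no _ | no _ = z≤n
    at-least : suc k ≤ roots xᵏ-1
    at-least = ℕP.≤-trans (ℕP.≤-reflexive (begin
        suc k                                       ≡⟨ ℕP.+-comm 1 k ⟩
        k ℕ.+ 1                                     ≡⟨ cong₂ ℕ._+_ (sym #C₀) (sym (Σ-point1 n)) ⟩
        Σ (λ x → 𝟙 (C₀? x)) ℕ.+ Σ (λ x → [ x ≐ n ])  ≡⟨ sym (Σ-+ (λ x → 𝟙 (C₀? x)) (λ x → [ x ≐ n ])) ⟩
        Σ (λ x → 𝟙 (C₀? x) ℕ.+ [ x ≐ n ])           ∎))
      (Σ-mono _ _ counted)
    at-most : roots xᵏ-1 ≤ k
    at-most = root-bound k xᵏ-1 (trans (cong suc (length-replicate (ℕ.pred k))) (sym k≡1+pk))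

  χ≡1⇒C₀ : ∀ x → χ x ≡ 1# → C₀ x
  χ≡1⇒C₀ x χx≡1 with classify x
  ... | inj₁ x≡0 = ⊥-elim (0≢1 (trans (sym χ0) (trans (cong χ (sym x≡0)) χx≡1)))
  ... | inj₂ (inj₁ c₀) = c₀
  ... | inj₂ (inj₂ c₁) = ⊥-elim (1≢-1 (trans (sym χx≡1) (χ-C₁ x c₁)))

  χ≡-1⇒C₁ : ∀ x → χ x ≡ - 1# → C₁ x
  χ≡-1⇒C₁ x χx≡-1 with classify x
  ... | inj₁ x≡0 = ⊥-elim (-‿≢0 1# 1≢0 (trans (sym χx≡-1) (trans (cong χ x≡0) χ0)))
  ... | inj₂ (inj₁ c₀) = ⊥-elim (1≢-1 (trans (sym (χ-C₀ x c₀)) χx≡-1))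
  ... | inj₂ (inj₂ c₁) = c₁

  same-class : ∀ a b → χ a ≡ χ b → 𝟙 (C₀? a) ≡ 𝟙 (C₀? b)
  same-class a b χa≡χb = 𝟙-cong (C₀? a) (C₀? b) (λ c₀ → χ≡1⇒C₀ b (trans (sym χa≡χb) (χ-C₀ a c₀)))
                                              (λ c₀ → χ≡1⇒C₀ a (trans χa≡χb (χ-C₀ b c₀)))

  opposite-class : ∀ a b → ¬ b ≡ 0# → χ a ≡ - χ b → 𝟙 (C₀? a) ℕ.+ 𝟙 (C₀? b) ≡ 1
  opposite-class a b b≢0 χa≡-χb with χ≡±1 b b≢0
  ... | inj₁ χb≡1 = cong₂ ℕ._+_ (𝟙-no (C₀? a) (λ c₀ → 1≢-1 (trans (sym (χ-C₀ a c₀)) (trans χa≡-χb (cong -_ χb≡1)))))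
                                (𝟙-yes (C₀? b) (χ≡1⇒C₀ b χb≡1))
  ... | inj₂ χb≡-1 = cong₂ ℕ._+_ (𝟙-yes (C₀? a) (χ≡1⇒C₀ a (trans χa≡-χb (trans (cong -_ χb≡-1) (RingProps.-‿involutive 1#)))))
                                 (𝟙-no (C₀? b) (λ c₀ → 1≢-1 (trans (sym (χ-C₀ b c₀)) χb≡-1)))

  χ-neg : ∀ a → χ (- a) ≡ χ (- 1#) * χ a
  χ-neg a = trans (cong χ (solve 1 (λ a → :- a := (:- :1) :* a) refl a)) (χ-mul (- 1#) a)

  -1^even : ∀ m → (- 1#) ^ᶠ (m ℕ.+ m) ≡ 1#
  -1^even zero = refl
  -1^even (suc m) = begin
    - 1# * (- 1#) ^ᶠ (m ℕ.+ suc m)      ≡⟨ cong (λ n → - 1# * (- 1#) ^ᶠ n) (ℕP.+-suc m m) ⟩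
    - 1# * (- 1# * (- 1#) ^ᶠ (m ℕ.+ m)) ≡⟨ cong (λ z → - 1# * (- 1# * z)) (-1^even m) ⟩
    - 1# * (- 1# * 1#)                 ≡⟨ solve 0 ((:- :1) :* ((:- :1) :* :1) := :1) refl ⟩
    1#                                 ∎

  χ-1-even : ∀ m → k ≡ m ℕ.+ m → χ (- 1#) ≡ 1#
  χ-1-even m k≡2m = trans (cong ((- 1#) ^ᶠ_) k≡2m) (-1^even m)

  χ-1-odd : ∀ m → k ≡ suc (m ℕ.+ m) → χ (- 1#) ≡ - 1#
  χ-1-odd m k≡2m+1 = trans (cong ((- 1#) ^ᶠ_) k≡2m+1)
    (trans (cong (- 1# *_) (-1^even m)) (*-identityʳ (- 1#)))

module SquareDifferences {q : ℕ} (F : FiniteField q) (k : ℕ) (q≡2k+1 : q ≡ suc (k ℕ.+ k))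
  (d : FiniteField.Carrier F) (d≢0 : ¬ d ≡ FiniteField.0# F) where
  open import Relation.Nullary using (¬_; yes; no)
  open import Relation.Binary.PropositionalEquality

  open import Relation.Nullary.Decidable using (¬?)
  open ≡-Reasoning

  open Counting
  open FieldFacts F
  open QuadraticCharacter F k q≡2k+1 using (two-nonzero; sqrts)

  private
    ½ : Carrier
    ½ = inv two two-nonzero

    two-½ : two * ½ ≡ 1#
    two-½ = inv-r two two-nonzero

  solutions-for : ∀ z → Σ (λ y → [ z * (z + two * y) ≐ d ]) ≡ 𝟙 (¬? (z ≟ 0#))
  solutions-for z with z ≟ 0#
  ... | yes z≡0 = Σ-zero _ (λ y → 𝟙-no ((z * (z + two * y)) ≟ d)
                    (λ e → d≢0 (trans (sym e) (trans (cong (_* (z + two * y)) z≡0) (zeroˡ _)))))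
  ... | no z≢0 = trans (Σ-cong (λ y → 𝟙-cong ((z * (z + two * y)) ≟ d) (y ≟ y₀) (solution y) (is-solution y)))
                       (Σ-point1 y₀)
    where
    z⁻¹ = inv z z≢0
    y₀ = ½ * (d * z⁻¹ - z)
    z·dz⁻¹ : z * (d * z⁻¹) ≡ d
    z·dz⁻¹ = trans (solve 3 (λ z d w → z :* (d :* w) := d :* (z :* w)) refl z d z⁻¹)
                   (trans (cong (d *_) (inv-r z z≢0)) (*-identityʳ d))
    solution : ∀ y → z * (z + two * y) ≡ d → y ≡ y₀
    solution y e = begin
      y                          ≡⟨ sym (*-identityˡ y) ⟩
      1# * y                     ≡⟨ cong (_* y) (sym (inv-l two two-nonzero)) ⟩
      (½ * two) * y              ≡⟨ solve 4 (λ h t y z → (h :* t) :* y := h :* ((z :+ t :* y) :- z)) refl ½ two y z ⟩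
      ½ * ((z + two * y) - z)    ≡⟨ cong (λ w → ½ * (w - z)) (*-cancelˡ z z≢0 (trans e (sym z·dz⁻¹))) ⟩
      ½ * (d * z⁻¹ - z)          ∎
    is-solution : ∀ y → y ≡ y₀ → z * (z + two * y) ≡ d
    is-solution y refl = begin
      z * (z + two * (½ * (d * z⁻¹ - z)))   ≡⟨ solve 4 (λ z t h w → z :* (z :+ t :* (h :* w)) := z :* (z :+ (t :* h) :* w)) refl z two ½ (d * z⁻¹ - z) ⟩
      z * (z + (two * ½) * (d * z⁻¹ - z))   ≡⟨ cong (λ w → z * (z + w * (d * z⁻¹ - z))) two-½ ⟩
      z * (z + 1# * (d * z⁻¹ - z))          ≡⟨ solve 2 (λ z w → z :* (z :+ :1 :* (w :- z)) := z :* w) refl z (d * z⁻¹) ⟩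
      z * (d * z⁻¹)                         ≡⟨ z·dz⁻¹ ⟩
      d                                     ∎

  solution-count : Σ (λ x → Σ (λ y → [ y * y ≐ x * x - d ])) ≡ k ℕ.+ k
  solution-count = begin
    Σ (λ x → Σ (λ y → [ y * y ≐ x * x - d ]))
      ≡⟨ Σ-swap (λ x y → [ y * y ≐ x * x - d ]) ⟩
    Σ (λ y → Σ (λ x → [ y * y ≐ x * x - d ]))
      ≡⟨ Σ-cong (λ y → Σ-reindex (_+ y) (_- y)
            (λ x → solve 2 (λ x y → (x :- y) :+ y := x) refl x y)
            (λ x → solve 2 (λ x y → (x :+ y) :- y := x) refl x y) (λ x → [ y * y ≐ x * x - d ])) ⟩
    Σ (λ y → Σ (λ z → [ y * y ≐ (z + y) * (z + y) - d ]))
      ≡⟨ Σ-cong (λ y → Σ-cong (λ z → 𝟙-cong ((y * y) ≟ ((z + y) * (z + y) - d)) ((z * (z + two * y)) ≟ d)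
                                        (factorised z y) (unfactorised z y))) ⟩
    Σ (λ y → Σ (λ z → [ z * (z + two * y) ≐ d ]))
      ≡⟨ Σ-swap (λ y z → [ z * (z + two * y) ≐ d ]) ⟩
    Σ (λ z → Σ (λ y → [ z * (z + two * y) ≐ d ]))
      ≡⟨ Σ-cong solutions-for ⟩
    Σ (λ z → 𝟙 (¬? (z ≟ 0#)))
      ≡⟨ nonzero-count q≡2k+1 ⟩
    k ℕ.+ k ∎
    where
    identity : ∀ z y → z * (z + two * y) ≡ (z + y) * (z + y) - y * y
    identity = solve 2 (λ z y → z :* (z :+ :2 :* y) := (z :+ y) :* (z :+ y) :- y :* y) refl
    factorised : ∀ z y → y * y ≡ (z + y) * (z + y) - d → z * (z + two * y) ≡ d
    factorised z y e = trans (identity z y) (trans (cong (λ w → (z + y) * (z + y) - w) e)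
                         (solve 2 (λ s d → s :- (s :- d) := d) refl ((z + y) * (z + y)) d))
    unfactorised : ∀ z y → z * (z + two * y) ≡ d → y * y ≡ (z + y) * (z + y) - d
    unfactorised z y e = trans (solve 2 (λ s w → w := s :- (s :- w)) refl ((z + y) * (z + y)) (y * y))
                           (cong (λ w → (z + y) * (z + y) - w) (trans (sym (identity z y)) e))

  -- Σ_u sqrts(u) sqrts(u - d) counts the same solutions, grouped by u = x².
  sqrts-correlation : Σ (λ u → sqrts u ℕ.* sqrts (u - d)) ≡ k ℕ.+ k
  sqrts-correlation = begin
    Σ (λ u → sqrts u ℕ.* sqrts (u - d))
      ≡⟨ Σ-cong (λ u → trans (sym (Σ-*ʳ (λ x → [ x * x ≐ u ]) (sqrts (u - d))))
                             (Σ-cong (λ x → sym (Σ-*ˡ [ x * x ≐ u ] (λ y → [ y * y ≐ u - d ]))))) ⟩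
    Σ (λ u → Σ (λ x → Σ (λ y → [ x * x ≐ u ] ℕ.* [ y * y ≐ u - d ])))
      ≡⟨ Σ-swap (λ u x → Σ (λ y → [ x * x ≐ u ] ℕ.* [ y * y ≐ u - d ])) ⟩
    Σ (λ x → Σ (λ u → Σ (λ y → [ x * x ≐ u ] ℕ.* [ y * y ≐ u - d ])))
      ≡⟨ Σ-cong (λ x → Σ-swap (λ u y → [ x * x ≐ u ] ℕ.* [ y * y ≐ u - d ])) ⟩
    Σ (λ x → Σ (λ y → Σ (λ u → [ x * x ≐ u ] ℕ.* [ y * y ≐ u - d ])))
      ≡⟨ Σ-cong (λ x → Σ-cong (λ y → trans (Σ-cong (λ u → cong (ℕ._* [ y * y ≐ u - d ]) (≐-sym (x * x) u)))
                                            (Σ-point (x * x) (λ u → [ y * y ≐ u - d ])))) ⟩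
    Σ (λ x → Σ (λ y → [ y * y ≐ x * x - d ]))
      ≡⟨ solution-count ⟩
    k ℕ.+ k ∎

module Multiplicities {q : ℕ} (F : FiniteField q) (k : ℕ) (q≡2k+1 : q ≡ suc (k ℕ.+ k)) where
  open import Data.Nat using (_<_; _∸_; s≤s)
  open import Relation.Binary.PropositionalEquality

  import Data.Nat.Properties as ℕP
  open import Data.Nat.Tactic.RingSolver using () renaming (solve to ℕ-solve)
  open import Data.List using (_∷_; [])
  open import Data.Product using (_×_; _,_; proj₁; proj₂)
  open import Relation.Nullary using (¬_)
  open import Function.Base using (_∘_)
  open ≡-Reasoning

  open Counting
  open FieldFacts F
  open QuadraticCharacter F k q≡2k+1
  open FF F using (mult; M)

  f : Carrier → Carrier
  f x = x ^ᶠ k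

  M-as-level : ∀ j c → M j f c ≡ level (mult f c) j
  M-as-level j c = length-filter (λ y → mult f c y ℕ.≟ j)

  mult-by-class : ∀ c y → mult f c y ≡
    [ 0# ≐ y ] ℕ.+ (Σ (λ x → 𝟙 (C₀? x) ℕ.* [ 1# - c * x ≐ y ]) ℕ.+ Σ (λ x → 𝟙 (C₁? x) ℕ.* [ - 1# - c * x ≐ y ]))
  mult-by-class c y = begin
    mult f c y
      ≡⟨ length-filter (λ x → (f x - c * x) ≟ y) ⟩
    Σ (λ x → [ χ x - c * x ≐ y ])
      ≡⟨ Σ-by-class (λ x → [ χ x - c * x ≐ y ]) ⟩
    [ χ 0# - c * 0# ≐ y ] ℕ.+ (Σ (λ x → 𝟙 (C₀? x) ℕ.* [ χ x - c * x ≐ y ]) ℕ.+ Σ (λ x → 𝟙 (C₁? x) ℕ.* [ χ x - c * x ≐ y ]))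
      ≡⟨ cong₂ ℕ._+_ (cong (λ v → [ v ≐ y ]) at-zero)
           (cong₂ ℕ._+_ (Σ-restrict-cong C₀? (λ x c₀ → cong (λ v → [ v - c * x ≐ y ]) (χ-C₀ x c₀)))
                        (Σ-restrict-cong C₁? (λ x c₁ → cong (λ v → [ v - c * x ≐ y ]) (χ-C₁ x c₁)))) ⟩
    [ 0# ≐ y ] ℕ.+ (Σ (λ x → 𝟙 (C₀? x) ℕ.* [ 1# - c * x ≐ y ]) ℕ.+ Σ (λ x → 𝟙 (C₁? x) ℕ.* [ - 1# - c * x ≐ y ])) ∎
    where
    at-zero : χ 0# - c * 0# ≡ 0#
    at-zero = trans (cong (_- c * 0#) χ0) (solve 1 (λ c → :0 :- c :* :0 := :0) refl c)

  m₀ : Carrier → ℕ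
  m₀ y = [ 0# ≐ y ] ℕ.+ (k ℕ.* [ 1# ≐ y ] ℕ.+ k ℕ.* [ - 1# ≐ y ])

  mult-zero-slope : ∀ y → mult f 0# y ≡ m₀ y
  mult-zero-slope y = trans (mult-by-class 0# y) (cong ([ 0# ≐ y ] ℕ.+_) (cong₂ ℕ._+_
    (trans (Σ-cong (λ x → cong (λ v → 𝟙 (C₀? x) ℕ.* [ v ≐ y ]) (no-slope 1# x)))
           (trans (Σ-*ʳ (λ x → 𝟙 (C₀? x)) [ 1# ≐ y ]) (cong (ℕ._* [ 1# ≐ y ]) #C₀)))
    (trans (Σ-cong (λ x → cong (λ v → 𝟙 (C₁? x) ℕ.* [ v ≐ y ]) (no-slope (- 1#) x)))
           (trans (Σ-*ʳ (λ x → 𝟙 (C₁? x)) [ - 1# ≐ y ]) (cong (ℕ._* [ - 1# ≐ y ]) #C₁)))))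
    where
    no-slope : ∀ a x → a - 0# * x ≡ a
    no-slope = solve 2 (λ a x → a :- :0 :* x := a) refl

  three-updates : ∀ L₁ L₂ L₃ z o κ Q → L₁ ℕ.+ z ≡ Q ℕ.+ κ → L₂ ℕ.+ z ≡ L₁ ℕ.+ κ → L₃ ℕ.+ z ≡ L₂ ℕ.+ o →
                  L₃ ℕ.+ 3 ℕ.* z ≡ Q ℕ.+ o ℕ.+ 2 ℕ.* κ
  three-updates L₁ L₂ L₃ z o κ Q e₁ e₂ e₃ = begin
    L₃ ℕ.+ 3 ℕ.* z                ≡⟨ ℕ-solve (L₃ ∷ z ∷ []) ⟩
    (L₃ ℕ.+ z) ℕ.+ (z ℕ.+ z)      ≡⟨ cong (ℕ._+ (z ℕ.+ z)) e₃ ⟩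
    (L₂ ℕ.+ o) ℕ.+ (z ℕ.+ z)      ≡⟨ ℕ-solve (L₂ ∷ o ∷ z ∷ []) ⟩
    (L₂ ℕ.+ z) ℕ.+ (o ℕ.+ z)      ≡⟨ cong (ℕ._+ (o ℕ.+ z)) e₂ ⟩
    (L₁ ℕ.+ κ) ℕ.+ (o ℕ.+ z)      ≡⟨ ℕ-solve (L₁ ∷ κ ∷ o ∷ z ∷ []) ⟩
    (L₁ ℕ.+ z) ℕ.+ (κ ℕ.+ o)      ≡⟨ cong (ℕ._+ (κ ℕ.+ o)) e₁ ⟩
    (Q ℕ.+ κ) ℕ.+ (κ ℕ.+ o)       ≡⟨ ℕ-solve (Q ∷ κ ∷ o ∷ []) ⟩
    Q ℕ.+ o ℕ.+ 2 ℕ.* κ           ∎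

  -- m₀ arises from the zero function by raising its value at -1 to k, at 1 to k
  -- and at 0 to 1; each step moves one point between levels.
  level-m₀ : ∀ j → level m₀ j ℕ.+ 3 ℕ.* 𝟙 (0 ℕ.≟ j) ≡ q ℕ.* 𝟙 (0 ℕ.≟ j) ℕ.+ 𝟙 (1 ℕ.≟ j) ℕ.+ 2 ℕ.* 𝟙 (k ℕ.≟ j)
  level-m₀ j = three-updates (level g₁ j) (level g₂ j) (level m₀ j) (𝟙 (0 ℕ.≟ j)) (𝟙 (1 ℕ.≟ j)) (𝟙 (k ℕ.≟ j))
                             (q ℕ.* 𝟙 (0 ℕ.≟ j)) step₁ step₂ step₃
    where
    g₁ g₂ : Carrier → ℕ
    g₁ y = k ℕ.* [ - 1# ≐ y ]
    g₂ y = k ℕ.* [ 1# ≐ y ] ℕ.+ g₁ y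
    k·miss : ∀ a y → ¬ a ≡ y → k ℕ.* [ a ≐ y ] ≡ 0
    k·miss a y a≢y = trans (cong (k ℕ.*_) (𝟙-no (a ≟ y) a≢y)) (ℕP.*-zeroʳ k)
    k·hit : ∀ a → k ℕ.* [ a ≐ a ] ≡ k
    k·hit a = trans (cong (k ℕ.*_) (𝟙-yes (a ≟ a) refl)) (ℕP.*-identityʳ k)
    -1≢0 : ¬ - 1# ≡ 0#
    -1≢0 = -‿≢0 1# 1≢0
    at : ∀ {g : Carrier → ℕ} {a v} → g a ≡ v → 𝟙 (g a ℕ.≟ j) ≡ 𝟙 (v ℕ.≟ j)
    at g≡v = cong (λ v → 𝟙 (v ℕ.≟ j)) g≡v
    step₁ : level g₁ j ℕ.+ 𝟙 (0 ℕ.≟ j) ≡ q ℕ.* 𝟙 (0 ℕ.≟ j) ℕ.+ 𝟙 (k ℕ.≟ j)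
    step₁ = trans (level-update (λ _ → 0) g₁ (- 1#) (λ u u≢-1 → sym (k·miss (- 1#) u (λ e → u≢-1 (sym e)))) j)
                  (cong₂ ℕ._+_ (Σ-const (𝟙 (0 ℕ.≟ j))) (at {g₁} (k·hit (- 1#))))
    step₂ : level g₂ j ℕ.+ 𝟙 (0 ℕ.≟ j) ≡ level g₁ j ℕ.+ 𝟙 (k ℕ.≟ j)
    step₂ = trans (cong (level g₂ j ℕ.+_) (sym (at {g₁} (k·miss (- 1#) 1# (λ e → 1≢-1 (sym e))))))
           (trans (level-update g₁ g₂ 1# (λ u u≢1 → sym (cong (ℕ._+ g₁ u) (k·miss 1# u (λ e → u≢1 (sym e))))) j)
                  (cong (level g₁ j ℕ.+_) (at {g₂} (trans (cong₂ ℕ._+_ (k·hit 1#) (k·miss (- 1#) 1# (λ e → 1≢-1 (sym e))))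
                                                          (ℕP.+-identityʳ k)))))
    step₃ : level m₀ j ℕ.+ 𝟙 (0 ℕ.≟ j) ≡ level g₂ j ℕ.+ 𝟙 (1 ℕ.≟ j)
    step₃ = trans (cong (level m₀ j ℕ.+_) (sym (at {g₂} (cong₂ ℕ._+_ (k·miss 1# 0# 1≢0) (k·miss (- 1#) 0# -1≢0)))))
           (trans (level-update g₂ m₀ 0# (λ u u≢0 → sym (cong (ℕ._+ g₂ u) (𝟙-no (0# ≟ u) (λ e → u≢0 (sym e))))) j)
                  (cong (level g₂ j ℕ.+_) (at {m₀} (cong₂ ℕ._+_ (𝟙-yes (0# ≟ 0#) refl) (cong₂ ℕ._+_ (k·miss 1# 0# 1≢0) (k·miss (- 1#) 0# -1≢0))))))
  level-zero-slope : ∀ j → M j f 0# ℕ.+ 3 ℕ.* 𝟙 (0 ℕ.≟ j) ≡ q ℕ.* 𝟙 (0 ℕ.≟ j) ℕ.+ 𝟙 (1 ℕ.≟ j) ℕ.+ 2 ℕ.* 𝟙 (k ℕ.≟ j)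
  level-zero-slope j = trans (cong (ℕ._+ 3 ℕ.* 𝟙 (0 ℕ.≟ j)) (trans (M-as-level j 0#) (level-cong mult-zero-slope j))) (level-m₀ j)

  k≥2 : 3 < q → k ≢ 0 × k ≢ 1
  k≥2 = go q≡2k+1
    where
    go : ∀ {n m} → n ≡ suc (m ℕ.+ m) → 3 < n → m ≢ 0 × m ≢ 1
    go {m = zero} refl (s≤s ())
    go {m = suc zero} refl (s≤s (s≤s (s≤s ())))
    go {m = suc (suc m)} _ _ = (λ ()) , (λ ())

  zero-slope : 3 < q → M 0 f 0# ≡ q ∸ 3 × M 1 f 0# ≡ 1 × M k f 0# ≡ 2 ×
                       (∀ j → j ≢ 0 → j ≢ 1 → j ≢ k → M j f 0# ≡ 0)
  zero-slope 3<q = at-0 , at-1 , at-k , elsewhere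
    where
    miss : ∀ {a b} → a ≢ b → 𝟙 (a ℕ.≟ b) ≡ 0
    miss a≢b = 𝟙-no (_ ℕ.≟ _) a≢b
    k≢0 = proj₁ (k≥2 3<q)
    k≢1 = proj₂ (k≥2 3<q)
    at-0 : M 0 f 0# ≡ q ∸ 3
    at-0 = begin
      M 0 f 0#                 ≡⟨ sym (ℕP.m+n∸n≡m (M 0 f 0#) 3) ⟩
      M 0 f 0# ℕ.+ 3 ∸ 3       ≡⟨ cong (_∸ 3) (level-zero-slope 0) ⟩
      q ℕ.* 1 ℕ.+ 0 ℕ.+ 2 ℕ.* 𝟙 (k ℕ.≟ 0) ∸ 3 ≡⟨ cong (λ n → q ℕ.* 1 ℕ.+ 0 ℕ.+ 2 ℕ.* n ∸ 3) (miss k≢0) ⟩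
      q ℕ.* 1 ℕ.+ 0 ℕ.+ 0 ∸ 3  ≡⟨ cong (_∸ 3) (trans (ℕP.+-identityʳ _) (trans (ℕP.+-identityʳ _) (ℕP.*-identityʳ q))) ⟩
      q ∸ 3                    ∎
    at-1 : M 1 f 0# ≡ 1
    at-1 = begin
      M 1 f 0#                                  ≡⟨ sym (ℕP.+-identityʳ (M 1 f 0#)) ⟩
      M 1 f 0# ℕ.+ 3 ℕ.* 0                      ≡⟨ level-zero-slope 1 ⟩
      q ℕ.* 0 ℕ.+ 1 ℕ.+ 2 ℕ.* 𝟙 (k ℕ.≟ 1)       ≡⟨ cong (λ n → q ℕ.* 0 ℕ.+ 1 ℕ.+ 2 ℕ.* n) (miss k≢1) ⟩
      q ℕ.* 0 ℕ.+ 1 ℕ.+ 2 ℕ.* 0                 ≡⟨ ℕ-solve (q ∷ []) ⟩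
      1                                         ∎
    at-k : M k f 0# ≡ 2
    at-k = begin
      M k f 0#                                                            ≡⟨ sym (ℕP.+-identityʳ (M k f 0#)) ⟩
      M k f 0# ℕ.+ 3 ℕ.* 0                                                ≡⟨ cong (λ n → M k f 0# ℕ.+ 3 ℕ.* n) (sym (miss (k≢0 ∘ sym))) ⟩
      M k f 0# ℕ.+ 3 ℕ.* 𝟙 (0 ℕ.≟ k)                                      ≡⟨ level-zero-slope k ⟩
      q ℕ.* 𝟙 (0 ℕ.≟ k) ℕ.+ 𝟙 (1 ℕ.≟ k) ℕ.+ 2 ℕ.* 𝟙 (k ℕ.≟ k)              ≡⟨ cong₂ (λ a b → q ℕ.* a ℕ.+ b ℕ.+ 2 ℕ.* 𝟙 (k ℕ.≟ k))
                                                                                (miss (k≢0 ∘ sym)) (miss (k≢1 ∘ sym)) ⟩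
      q ℕ.* 0 ℕ.+ 0 ℕ.+ 2 ℕ.* 𝟙 (k ℕ.≟ k)                                  ≡⟨ cong (λ n → q ℕ.* 0 ℕ.+ 0 ℕ.+ 2 ℕ.* n) (𝟙-yes (k ℕ.≟ k) refl) ⟩
      q ℕ.* 0 ℕ.+ 0 ℕ.+ 2 ℕ.* 1                                            ≡⟨ ℕ-solve (q ∷ []) ⟩
      2                                                                   ∎
    elsewhere : ∀ j → j ≢ 0 → j ≢ 1 → j ≢ k → M j f 0# ≡ 0
    elsewhere j j≢0 j≢1 j≢k = begin
      M j f 0#                                                  ≡⟨ sym (ℕP.+-identityʳ (M j f 0#)) ⟩
      M j f 0# ℕ.+ 3 ℕ.* 0                                      ≡⟨ cong (λ n → M j f 0# ℕ.+ 3 ℕ.* n) (sym (miss (j≢0 ∘ sym))) ⟩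
      M j f 0# ℕ.+ 3 ℕ.* 𝟙 (0 ℕ.≟ j)                            ≡⟨ level-zero-slope j ⟩
      q ℕ.* 𝟙 (0 ℕ.≟ j) ℕ.+ 𝟙 (1 ℕ.≟ j) ℕ.+ 2 ℕ.* 𝟙 (k ℕ.≟ j)    ≡⟨ cong₂ (λ a b → q ℕ.* a ℕ.+ b ℕ.+ 2 ℕ.* 𝟙 (k ℕ.≟ j))
                                                                      (miss (j≢0 ∘ sym)) (miss (j≢1 ∘ sym)) ⟩
      q ℕ.* 0 ℕ.+ 0 ℕ.+ 2 ℕ.* 𝟙 (k ℕ.≟ j)                        ≡⟨ cong (λ n → q ℕ.* 0 ℕ.+ 0 ℕ.+ 2 ℕ.* n) (miss (j≢k ∘ sym)) ⟩
      q ℕ.* 0 ℕ.+ 0 ℕ.+ 2 ℕ.* 0                                  ≡⟨ ℕ-solve (q ∷ []) ⟩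
      0                                                         ∎

-- The multiset {x^k - c x} for c ≠ 0.  Writing its values as y = 1 - c u, the
-- value y is taken once at x = 0 if u = 1/c, once at the square x = u and once
-- at the nonsquare x = u - d, where d = 2/c.  So up to the single point u = 1/c
-- the multiplicities are s(u) = [u ∈ C₀] + [u - d ∈ C₁], whose levels are
-- governed by β = #{u ∈ C₀ : u - d ∈ C₁}; the square-difference count pins down β.
module NonzeroSlope {q : ℕ} (F : FiniteField q) (k : ℕ) (q≡2k+1 : q ≡ suc (k ℕ.+ k))
  (c : FiniteField.Carrier F) (c≢0 : ¬ c ≡ FiniteField.0# F) where
  open import Relation.Nullary using (¬_; yes; no)
  open import Relation.Binary.PropositionalEquality

  import Data.Nat.Properties as ℕP
  open import Data.Nat.Tactic.RingSolver using () renaming (solve to ℕ-solve)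
  open import Data.List using (_∷_; [])
  open import Data.Product using (_,_; proj₂)
  open ≡-Reasoning

  open Counting
  open FieldFacts F
  open QuadraticCharacter F k q≡2k+1
  open Multiplicities F k q≡2k+1
  open FF F using (mult; M; C₀; C₁)

  c⁻¹ : Carrier
  c⁻¹ = inv c c≢0

  d : Carrier
  d = two * c⁻¹

  c⁻¹≢0 : ¬ c⁻¹ ≡ 0#
  c⁻¹≢0 c⁻¹≡0 = 1≢0 (trans (sym (inv-r c c≢0)) (trans (cong (c *_) c⁻¹≡0) (zeroʳ c)))

  d≢0 : ¬ d ≡ 0#
  d≢0 = *-nonzero two c⁻¹ two-nonzero c⁻¹≢0

  σ τ : Carrier → Carrier
  σ u = 1# - c * u
  τ y = c⁻¹ * (1# - y)

  στ : ∀ y → σ (τ y) ≡ y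
  στ y = begin
    1# - c * (c⁻¹ * (1# - y))  ≡⟨ solve 3 (λ c i y → :1 :- c :* (i :* (:1 :- y)) := :1 :- (c :* i) :* (:1 :- y)) refl c c⁻¹ y ⟩
    1# - (c * c⁻¹) * (1# - y)  ≡⟨ cong (λ w → 1# - w * (1# - y)) (inv-r c c≢0) ⟩
    1# - 1# * (1# - y)         ≡⟨ solve 1 (λ y → :1 :- :1 :* (:1 :- y) := y) refl y ⟩
    y                          ∎

  τσ : ∀ u → τ (σ u) ≡ u
  τσ u = begin
    c⁻¹ * (1# - (1# - c * u))  ≡⟨ solve 3 (λ c i u → i :* (:1 :- (:1 :- c :* u)) := (c :* i) :* u) refl c c⁻¹ u ⟩
    (c * c⁻¹) * u              ≡⟨ cong (_* u) (inv-r c c≢0) ⟩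
    1# * u                     ≡⟨ *-identityˡ u ⟩
    u                          ∎

  σ-injective : ∀ {u v} → σ u ≡ σ v → u ≡ v
  σ-injective {u} {v} e = trans (sym (τσ u)) (trans (cong τ e) (τσ v))

  hit-by-zero : ∀ u → [ 0# ≐ σ u ] ≡ [ u ≐ c⁻¹ ]
  hit-by-zero u = 𝟙-cong (0# ≟ σ u) (u ≟ c⁻¹)
    (λ e → σ-injective (trans (sym e) (sym σc⁻¹≡0)))
    (λ u≡c⁻¹ → trans (sym σc⁻¹≡0) (cong σ (sym u≡c⁻¹)))
    where
    σc⁻¹≡0 : σ c⁻¹ ≡ 0#
    σc⁻¹≡0 = trans (cong (λ w → 1# - w) (inv-r c c≢0)) (-‿inverseʳ 1#)

  hit-by-square : ∀ u x → [ 1# - c * x ≐ σ u ] ≡ [ x ≐ u ]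
  hit-by-square u x = 𝟙-cong ((1# - c * x) ≟ σ u) (x ≟ u) σ-injective (cong σ)

  hit-by-nonsquare : ∀ u x → [ - 1# - c * x ≐ σ u ] ≡ [ x ≐ u - d ]
  hit-by-nonsquare u x = 𝟙-cong ((- 1# - c * x) ≟ σ u) (x ≟ (u - d))
    (shift-back x u)
    (λ x≡u-d → trans (cong (λ w → - 1# - c * w) x≡u-d)
                     (trans (sym (shifted (u - d))) (cong σ (solve 2 (λ u d → (u :- d) :+ d := u) refl u d))))
    where
    cd≡2 : c * d ≡ two
    cd≡2 = trans (solve 2 (λ c i → c :* (:2 :* i) := :2 :* (c :* i)) refl c c⁻¹)
                 (trans (cong (two *_) (inv-r c c≢0)) (*-identityʳ two))
    -- σ (v + d) = -1 - c v, because c d = 2.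
    shifted : ∀ v → σ (v + d) ≡ - 1# - c * v
    shifted v = begin
      1# - c * (v + d)        ≡⟨ solve 3 (λ c v d → :1 :- c :* (v :+ d) := (:- :1 :- c :* v) :+ (:2 :- c :* d)) refl c v d ⟩
      (- 1# - c * v) + (two - c * d) ≡⟨ cong (λ w → (- 1# - c * v) + (two - w)) cd≡2 ⟩
      (- 1# - c * v) + (two - two)   ≡⟨ cong ((- 1# - c * v) +_) (-‿inverseʳ two) ⟩
      (- 1# - c * v) + 0#     ≡⟨ +-identityʳ _ ⟩
      - 1# - c * v            ∎
    shift-back : ∀ x u → - 1# - c * x ≡ σ u → x ≡ u - d
    shift-back x u e = begin
      x                  ≡⟨ solve 2 (λ x d → x := (x :+ d) :- d) refl x d ⟩
      (x + d) - d        ≡⟨ cong (_- d) (σ-injective (trans (shifted x) e)) ⟩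
      u - d              ∎

  open TwoIndicators C₀? (λ u → C₁? (u - d)) public
    using (s) renaming (both to β; level-2 to level-s-2; level-above-2 to level-s-above-2)
  open TwoIndicators C₀? (λ u → C₁? (u - d)) using (level-0; level-1)

  mult-substituted : ∀ u → mult f c (σ u) ≡ [ u ≐ c⁻¹ ] ℕ.+ s u
  mult-substituted u = begin
    mult f c (σ u)
      ≡⟨ mult-by-class c (σ u) ⟩
    [ 0# ≐ σ u ] ℕ.+ (Σ (λ x → 𝟙 (C₀? x) ℕ.* [ 1# - c * x ≐ σ u ]) ℕ.+ Σ (λ x → 𝟙 (C₁? x) ℕ.* [ - 1# - c * x ≐ σ u ]))
      ≡⟨ cong₂ ℕ._+_ (hit-by-zero u) (cong₂ ℕ._+_
           (Σ-cong (λ x → trans (cong (𝟙 (C₀? x) ℕ.*_) (hit-by-square u x)) (ℕP.*-comm (𝟙 (C₀? x)) [ x ≐ u ])))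
           (Σ-cong (λ x → trans (cong (𝟙 (C₁? x) ℕ.*_) (hit-by-nonsquare u x)) (ℕP.*-comm (𝟙 (C₁? x)) [ x ≐ u - d ])))) ⟩
    [ u ≐ c⁻¹ ] ℕ.+ (Σ (λ x → [ x ≐ u ] ℕ.* 𝟙 (C₀? x)) ℕ.+ Σ (λ x → [ x ≐ u - d ] ℕ.* 𝟙 (C₁? x)))
      ≡⟨ cong ([ u ≐ c⁻¹ ] ℕ.+_) (cong₂ ℕ._+_ (Σ-point u (λ x → 𝟙 (C₀? x))) (Σ-point (u - d) (λ x → 𝟙 (C₁? x)))) ⟩
    [ u ≐ c⁻¹ ] ℕ.+ s u ∎

  -- Up to the point u = 1/c, the levels of the multiplicity function are those of s.
  M-shift : ∀ j → M j f c ℕ.+ 𝟙 (s c⁻¹ ℕ.≟ j) ≡ level s j ℕ.+ 𝟙 (suc (s c⁻¹) ℕ.≟ j)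
  M-shift j = begin
    M j f c ℕ.+ 𝟙 (s c⁻¹ ℕ.≟ j)
      ≡⟨ cong (ℕ._+ 𝟙 (s c⁻¹ ℕ.≟ j)) (trans (M-as-level j c) (level-reindex σ τ στ τσ (mult f c) j)) ⟩
    level (λ u → mult f c (σ u)) j ℕ.+ 𝟙 (s c⁻¹ ℕ.≟ j)
      ≡⟨ cong (ℕ._+ 𝟙 (s c⁻¹ ℕ.≟ j)) (level-cong mult-substituted j) ⟩
    level (λ u → [ u ≐ c⁻¹ ] ℕ.+ s u) j ℕ.+ 𝟙 (s c⁻¹ ℕ.≟ j)
      ≡⟨ level-update s (λ u → [ u ≐ c⁻¹ ] ℕ.+ s u) c⁻¹ (λ u u≢c⁻¹ → cong (ℕ._+ s u) (sym (𝟙-no (u ≟ c⁻¹) u≢c⁻¹))) j ⟩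
    level s j ℕ.+ 𝟙 ([ c⁻¹ ≐ c⁻¹ ] ℕ.+ s c⁻¹ ℕ.≟ j)
      ≡⟨ cong (λ v → level s j ℕ.+ 𝟙 (v ℕ.+ s c⁻¹ ℕ.≟ j)) (𝟙-yes (c⁻¹ ≟ c⁻¹) refl) ⟩
    level s j ℕ.+ 𝟙 (suc (s c⁻¹) ℕ.≟ j) ∎

  -- There are k points u with u - d a nonsquare (translation by d permutes F).
  #C₁-shifted : Σ (λ u → 𝟙 (C₁? (u - d))) ≡ k
  #C₁-shifted = trans (sym (Σ-reindex (λ u → u - d) (λ u → u + d)
                        (λ u → solve 2 (λ u d → (u :+ d) :- d := u) refl u d)
                        (λ u → solve 2 (λ u d → (u :- d) :+ d := u) refl u d) (λ u → 𝟙 (C₁? u))))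
                      #C₁

  level-s-0 : level s 0 ≡ suc β
  level-s-0 = ℕP.+-cancelʳ-≡ (k ℕ.+ k) (level s 0) (suc β) (begin
    level s 0 ℕ.+ (k ℕ.+ k)   ≡⟨ cong (level s 0 ℕ.+_) (sym (cong₂ ℕ._+_ #C₀ #C₁-shifted)) ⟩
    level s 0 ℕ.+ (Σ (λ u → 𝟙 (C₀? u)) ℕ.+ Σ (λ u → 𝟙 (C₁? (u - d)))) ≡⟨ level-0 ⟩
    q ℕ.+ β                   ≡⟨ cong (ℕ._+ β) q≡2k+1 ⟩
    suc (k ℕ.+ k) ℕ.+ β       ≡⟨ cong suc (ℕP.+-comm (k ℕ.+ k) β) ⟩
    suc β ℕ.+ (k ℕ.+ k)       ∎)

  level-s-1 : level s 1 ℕ.+ 2 ℕ.* β ≡ k ℕ.+ k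
  level-s-1 = trans level-1 (cong₂ ℕ._+_ #C₀ #C₁-shifted)

  M-shift-at : ∀ {v} → s c⁻¹ ≡ v → ∀ j → M j f c ℕ.+ 𝟙 (v ℕ.≟ j) ≡ level s j ℕ.+ 𝟙 (suc v ℕ.≟ j)
  M-shift-at {v} s≡v j = subst (λ w → M j f c ℕ.+ 𝟙 (w ℕ.≟ j) ≡ level s j ℕ.+ 𝟙 (suc w ℕ.≟ j)) s≡v (M-shift j)

  M-away : ∀ {v} → s c⁻¹ ≡ v → ∀ j → v ≢ j → suc v ≢ j → M j f c ≡ level s j
  M-away {v} s≡v j v≢j 1+v≢j = ℕP.+-cancelʳ-≡ 0 (M j f c) (level s j) (begin
    M j f c ℕ.+ 0                     ≡⟨ cong (M j f c ℕ.+_) (sym (𝟙-no (v ℕ.≟ j) v≢j)) ⟩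
    M j f c ℕ.+ 𝟙 (v ℕ.≟ j)           ≡⟨ M-shift-at s≡v j ⟩
    level s j ℕ.+ 𝟙 (suc v ℕ.≟ j)     ≡⟨ cong (level s j ℕ.+_) (𝟙-no (suc v ℕ.≟ j) 1+v≢j) ⟩
    level s j ℕ.+ 0                   ∎)

  α : ℕ
  α = Σ (λ u → 𝟙 (C₀? u) ℕ.* 𝟙 (C₀? (u - d)))

  [u-d≐0] : ∀ u → [ u - d ≐ 0# ] ≡ [ u ≐ d ]
  [u-d≐0] u = 𝟙-cong ((u - d) ≟ 0#) (u ≟ d) (-≡0⇒≡ u d) (λ u≡d → trans (cong (_- d) u≡d) (-‿inverseʳ d))

  -- Sorting the squares u by the class of u - d:  k = [d ∈ C₀] + α + β.
  squares-by-shift : k ≡ 𝟙 (C₀? d) ℕ.+ (α ℕ.+ β)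
  squares-by-shift = begin
    k
      ≡⟨ sym #C₀ ⟩
    Σ (λ u → 𝟙 (C₀? u))
      ≡⟨ Σ-cong (λ u → split (𝟙 (C₀? u)) [ u ≐ d ] (𝟙 (C₀? (u - d))) (𝟙 (C₁? (u - d)))
                        (trans (cong (ℕ._+ (𝟙 (C₀? (u - d)) ℕ.+ 𝟙 (C₁? (u - d)))) (sym ([u-d≐0] u))) (trichotomy (u - d)))) ⟩
    Σ (λ u → [ u ≐ d ] ℕ.* 𝟙 (C₀? u) ℕ.+ (𝟙 (C₀? u) ℕ.* 𝟙 (C₀? (u - d)) ℕ.+ 𝟙 (C₀? u) ℕ.* 𝟙 (C₁? (u - d))))
      ≡⟨ Σ-+ (λ u → [ u ≐ d ] ℕ.* 𝟙 (C₀? u)) (λ u → 𝟙 (C₀? u) ℕ.* 𝟙 (C₀? (u - d)) ℕ.+ 𝟙 (C₀? u) ℕ.* 𝟙 (C₁? (u - d))) ⟩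
    Σ (λ u → [ u ≐ d ] ℕ.* 𝟙 (C₀? u)) ℕ.+ Σ (λ u → 𝟙 (C₀? u) ℕ.* 𝟙 (C₀? (u - d)) ℕ.+ 𝟙 (C₀? u) ℕ.* 𝟙 (C₁? (u - d)))
      ≡⟨ cong₂ ℕ._+_ (Σ-point d (λ u → 𝟙 (C₀? u))) (Σ-+ (λ u → 𝟙 (C₀? u) ℕ.* 𝟙 (C₀? (u - d))) (λ u → 𝟙 (C₀? u) ℕ.* 𝟙 (C₁? (u - d)))) ⟩
    𝟙 (C₀? d) ℕ.+ (α ℕ.+ β) ∎
    where
    split : ∀ a z b₀ b₁ → z ℕ.+ (b₀ ℕ.+ b₁) ≡ 1 → a ≡ z ℕ.* a ℕ.+ (a ℕ.* b₀ ℕ.+ a ℕ.* b₁)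
    split a z b₀ b₁ sum≡1 = begin
      a                                  ≡⟨ sym (ℕP.*-identityʳ a) ⟩
      a ℕ.* 1                            ≡⟨ cong (a ℕ.*_) (sym sum≡1) ⟩
      a ℕ.* (z ℕ.+ (b₀ ℕ.+ b₁))          ≡⟨ ℕ-solve (a ∷ z ∷ b₀ ∷ b₁ ∷ []) ⟩
      z ℕ.* a ℕ.+ (a ℕ.* b₀ ℕ.+ a ℕ.* b₁) ∎

  -- Expanding Σ_u sqrts(u) sqrts(u - d) = 2k with sqrts = [· = 0] + 2 [· ∈ C₀]:
  -- 2 [-d ∈ C₀] + 2 [d ∈ C₀] + 4 α = 2k.
  correlation-identity : 2 ℕ.* 𝟙 (C₀? (- d)) ℕ.+ 2 ℕ.* 𝟙 (C₀? d) ℕ.+ 4 ℕ.* α ≡ k ℕ.+ k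
  correlation-identity = trans (sym expansion) (sqrts-correlation)
    where
    open SquareDifferences F k q≡2k+1 d d≢0 using (sqrts-correlation)
    A A′ : Carrier → ℕ
    A u = 𝟙 (C₀? u)
    A′ u = 𝟙 (C₀? (u - d))
    disjoint : ∀ u → [ u ≐ 0# ] ℕ.* [ u ≐ d ] ≡ 0
    disjoint u with u ≟ 0#
    ... | yes u≡0 = trans (ℕP.+-identityʳ _) (𝟙-no (u ≟ d) (λ u≡d → d≢0 (trans (sym u≡d) u≡0)))
    ... | no _ = refl
    product : ∀ z₀ z_d a a′ → z₀ ℕ.* z_d ≡ 0 →
      (z₀ ℕ.+ 2 ℕ.* a) ℕ.* (z_d ℕ.+ 2 ℕ.* a′) ≡ 2 ℕ.* (z₀ ℕ.* a′) ℕ.+ 2 ℕ.* (z_d ℕ.* a) ℕ.+ 4 ℕ.* (a ℕ.* a′)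
    product z₀ z_d a a′ z₀z_d≡0 = begin
      (z₀ ℕ.+ 2 ℕ.* a) ℕ.* (z_d ℕ.+ 2 ℕ.* a′)
        ≡⟨ ℕ-solve (z₀ ∷ z_d ∷ a ∷ a′ ∷ []) ⟩
      z₀ ℕ.* z_d ℕ.+ (2 ℕ.* (z₀ ℕ.* a′) ℕ.+ 2 ℕ.* (z_d ℕ.* a) ℕ.+ 4 ℕ.* (a ℕ.* a′))
        ≡⟨ cong (ℕ._+ (2 ℕ.* (z₀ ℕ.* a′) ℕ.+ 2 ℕ.* (z_d ℕ.* a) ℕ.+ 4 ℕ.* (a ℕ.* a′))) z₀z_d≡0 ⟩
      2 ℕ.* (z₀ ℕ.* a′) ℕ.+ 2 ℕ.* (z_d ℕ.* a) ℕ.+ 4 ℕ.* (a ℕ.* a′) ∎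
    expansion : Σ (λ u → sqrts u ℕ.* sqrts (u - d)) ≡ 2 ℕ.* 𝟙 (C₀? (- d)) ℕ.+ 2 ℕ.* 𝟙 (C₀? d) ℕ.+ 4 ℕ.* α
    expansion = begin
      Σ (λ u → sqrts u ℕ.* sqrts (u - d))
        ≡⟨ Σ-cong (λ u → trans (cong₂ ℕ._*_ (sqrts-value u) (trans (sqrts-value (u - d)) (cong (ℕ._+ 2 ℕ.* A′ u) ([u-d≐0] u))))
                               (product [ u ≐ 0# ] [ u ≐ d ] (A u) (A′ u) (disjoint u))) ⟩
      Σ (λ u → 2 ℕ.* ([ u ≐ 0# ] ℕ.* A′ u) ℕ.+ 2 ℕ.* ([ u ≐ d ] ℕ.* A u) ℕ.+ 4 ℕ.* (A u ℕ.* A′ u))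
        ≡⟨ trans (Σ-+ (λ u → 2 ℕ.* ([ u ≐ 0# ] ℕ.* A′ u) ℕ.+ 2 ℕ.* ([ u ≐ d ] ℕ.* A u)) (λ u → 4 ℕ.* (A u ℕ.* A′ u)))
                 (cong (ℕ._+ Σ (λ u → 4 ℕ.* (A u ℕ.* A′ u))) (Σ-+ (λ u → 2 ℕ.* ([ u ≐ 0# ] ℕ.* A′ u)) (λ u → 2 ℕ.* ([ u ≐ d ] ℕ.* A u)))) ⟩
      Σ (λ u → 2 ℕ.* ([ u ≐ 0# ] ℕ.* A′ u)) ℕ.+ Σ (λ u → 2 ℕ.* ([ u ≐ d ] ℕ.* A u)) ℕ.+ Σ (λ u → 4 ℕ.* (A u ℕ.* A′ u))
        ≡⟨ cong₂ ℕ._+_ (cong₂ ℕ._+_ (trans (Σ-*ˡ 2 (λ u → [ u ≐ 0# ] ℕ.* A′ u))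
                                           (cong (2 ℕ.*_) (trans (Σ-point 0# A′) (cong (λ v → 𝟙 (C₀? v)) (+-identityˡ (- d))))))
                                    (trans (Σ-*ˡ 2 (λ u → [ u ≐ d ] ℕ.* A u)) (cong (2 ℕ.*_) (Σ-point d A))))
                       (Σ-*ˡ 4 (λ u → A u ℕ.* A′ u)) ⟩
      2 ℕ.* 𝟙 (C₀? (- d)) ℕ.+ 2 ℕ.* 𝟙 (C₀? d) ℕ.+ 4 ℕ.* α ∎

  χ-c⁻¹ : χ c⁻¹ ≡ χ c
  χ-c⁻¹ = *-cancelˡ (χ c) (χ≢0 c c≢0) (begin
    χ c * χ c⁻¹   ≡⟨ sym (χ-mul c c⁻¹) ⟩
    χ (c * c⁻¹)   ≡⟨ cong χ (inv-r c c≢0) ⟩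
    χ 1#          ≡⟨ χ-C₀ 1# (1≢0 , 1# , *-identityˡ 1#) ⟩
    1#            ≡⟨ sym (χ-squared c c≢0) ⟩
    χ c * χ c     ∎)

  χ-d : χ d ≡ χ two * χ c
  χ-d = trans (χ-mul two c⁻¹) (cong (χ two *_) χ-c⁻¹)

  -- Since 1/c - d = -1/c, s counts 1/c as [1/c ∈ C₀] + [-1/c ∈ C₁].
  s-at-c⁻¹ : s c⁻¹ ≡ 𝟙 (C₀? c⁻¹) ℕ.+ 𝟙 (C₁? (- c⁻¹))
  s-at-c⁻¹ = cong (λ v → 𝟙 (C₀? c⁻¹) ℕ.+ 𝟙 (C₁? v)) (solve 1 (λ i → i :- :2 :* i := :- i) refl c⁻¹)

  -- If k = 2m then -1 is a square: β = m and 1/c is counted once by s.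
  module EvenCase (m : ℕ) (k≡2m : k ≡ m ℕ.+ m) where

    χ-neg-even : ∀ a → χ (- a) ≡ χ a
    χ-neg-even a = trans (χ-neg a) (trans (cong (_* χ a) (χ-1-even m k≡2m)) (*-identityˡ (χ a)))

    -- From 4([d ∈ C₀] + α) = 2k = 4m (as [-d ∈ C₀] = [d ∈ C₀]) and k = [d ∈ C₀] + α + β.
    β≡m : β ≡ m
    β≡m = ℕP.+-cancelˡ-≡ m β m (begin
      m ℕ.+ β                                 ≡⟨ cong (ℕ._+ β) (sym Ad+α≡m) ⟩
      𝟙 (C₀? d) ℕ.+ α ℕ.+ β                   ≡⟨ ℕP.+-assoc (𝟙 (C₀? d)) α β ⟩
      𝟙 (C₀? d) ℕ.+ (α ℕ.+ β)                 ≡⟨ sym squares-by-shift ⟩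
      k                                       ≡⟨ k≡2m ⟩
      m ℕ.+ m                                 ∎)
      where
      Ad+α≡m : 𝟙 (C₀? d) ℕ.+ α ≡ m
      Ad+α≡m = ℕP.*-cancelˡ-≡ (𝟙 (C₀? d) ℕ.+ α) m 4 (begin
        4 ℕ.* (𝟙 (C₀? d) ℕ.+ α)                                  ≡⟨ regroup (𝟙 (C₀? d)) α ⟩
        2 ℕ.* 𝟙 (C₀? d) ℕ.+ 2 ℕ.* 𝟙 (C₀? d) ℕ.+ 4 ℕ.* α          ≡⟨ cong (λ a → 2 ℕ.* a ℕ.+ 2 ℕ.* 𝟙 (C₀? d) ℕ.+ 4 ℕ.* α)
                                                                       (same-class d (- d) (sym (χ-neg-even d))) ⟩
        2 ℕ.* 𝟙 (C₀? (- d)) ℕ.+ 2 ℕ.* 𝟙 (C₀? d) ℕ.+ 4 ℕ.* α      ≡⟨ correlation-identity ⟩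
        k ℕ.+ k                                                  ≡⟨ cong₂ ℕ._+_ k≡2m k≡2m ⟩
        (m ℕ.+ m) ℕ.+ (m ℕ.+ m)                                  ≡⟨ ℕ-solve (m ∷ []) ⟩
        4 ℕ.* m                                                  ∎)
        where
        regroup : ∀ a b → 4 ℕ.* (a ℕ.+ b) ≡ 2 ℕ.* a ℕ.+ 2 ℕ.* a ℕ.+ 4 ℕ.* b
        regroup a b = ℕ-solve (a ∷ b ∷ [])

    -- 1/c and -1/c lie in the same class, so exactly one of the two brackets is 1.
    s-at-c⁻¹≡1 : s c⁻¹ ≡ 1
    s-at-c⁻¹≡1 = trans s-at-c⁻¹ (trans (cong (ℕ._+ 𝟙 (C₁? (- c⁻¹))) (same-class c⁻¹ (- c⁻¹) (sym (χ-neg-even c⁻¹))))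
                                       (C₀C₁-complement (- c⁻¹) (-‿≢0 c⁻¹ c⁻¹≢0)))

  -- If k = 2m + 1 then -1 is a nonsquare: α = m, β + [d ∈ C₀] = m + 1, and the
  -- count s(1/c) and the class of d depend on the class of c.
  module OddCase (m : ℕ) (k≡2m+1 : k ≡ suc (m ℕ.+ m)) where

    χ-neg-odd : ∀ a → χ (- a) ≡ - χ a
    χ-neg-odd a = trans (χ-neg a) (trans (cong (_* χ a) (χ-1-odd m k≡2m+1)) (solve 1 (λ x → (:- :1) :* x := :- x) refl (χ a)))

    -- Exactly one of ±d is a square, so 2 + 4α = 2k = 4m + 2.
    α≡m : α ≡ m
    α≡m = ℕP.*-cancelˡ-≡ α m 4 (ℕP.+-cancelˡ-≡ 2 (4 ℕ.* α) (4 ℕ.* m) (begin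
      2 ℕ.+ 4 ℕ.* α                                         ≡⟨ cong (λ a → 2 ℕ.* a ℕ.+ 4 ℕ.* α) (sym one-of-±d) ⟩
      2 ℕ.* (𝟙 (C₀? (- d)) ℕ.+ 𝟙 (C₀? d)) ℕ.+ 4 ℕ.* α       ≡⟨ regroup (𝟙 (C₀? (- d))) (𝟙 (C₀? d)) α ⟩
      2 ℕ.* 𝟙 (C₀? (- d)) ℕ.+ 2 ℕ.* 𝟙 (C₀? d) ℕ.+ 4 ℕ.* α   ≡⟨ correlation-identity ⟩
      k ℕ.+ k                                               ≡⟨ cong₂ ℕ._+_ k≡2m+1 k≡2m+1 ⟩
      suc (m ℕ.+ m) ℕ.+ suc (m ℕ.+ m)                       ≡⟨ ℕ-solve (m ∷ []) ⟩
      2 ℕ.+ 4 ℕ.* m                                         ∎))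
      where
      regroup : ∀ a b c → 2 ℕ.* (a ℕ.+ b) ℕ.+ 4 ℕ.* c ≡ 2 ℕ.* a ℕ.+ 2 ℕ.* b ℕ.+ 4 ℕ.* c
      regroup a b c = ℕ-solve (a ∷ b ∷ c ∷ [])
      one-of-±d : 𝟙 (C₀? (- d)) ℕ.+ 𝟙 (C₀? d) ≡ 1
      one-of-±d = opposite-class (- d) d d≢0 (χ-neg-odd d)

    -- Then k = [d ∈ C₀] + α + β gives the relation between β and the class of d.
    β+Ad≡1+m : β ℕ.+ 𝟙 (C₀? d) ≡ suc m
    β+Ad≡1+m = ℕP.+-cancelˡ-≡ m (β ℕ.+ 𝟙 (C₀? d)) (suc m) (begin
      m ℕ.+ (β ℕ.+ 𝟙 (C₀? d))          ≡⟨ regroup m β (𝟙 (C₀? d)) ⟩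
      𝟙 (C₀? d) ℕ.+ (m ℕ.+ β)          ≡⟨ cong (λ a → 𝟙 (C₀? d) ℕ.+ (a ℕ.+ β)) (sym α≡m) ⟩
      𝟙 (C₀? d) ℕ.+ (α ℕ.+ β)          ≡⟨ sym squares-by-shift ⟩
      k                                ≡⟨ k≡2m+1 ⟩
      suc (m ℕ.+ m)                    ≡⟨ sym (ℕP.+-suc m m) ⟩
      m ℕ.+ suc m                      ∎)
      where
      regroup : ∀ a b c → a ℕ.+ (b ℕ.+ c) ≡ c ℕ.+ (a ℕ.+ b)
      regroup a b c = ℕ-solve (a ∷ b ∷ c ∷ [])

    module SquareSlope (c∈C₀ : C₀ c) where

      -- 1/c is a square and -1/c a nonsquare.
      s-at-c⁻¹≡2 : s c⁻¹ ≡ 2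
      s-at-c⁻¹≡2 = trans s-at-c⁻¹ (cong₂ ℕ._+_
        (𝟙-yes (C₀? c⁻¹) (χ≡1⇒C₀ c⁻¹ χc⁻¹≡1))
        (𝟙-yes (C₁? (- c⁻¹)) (χ≡-1⇒C₁ (- c⁻¹) (trans (χ-neg-odd c⁻¹) (cong -_ χc⁻¹≡1)))))
        where
        χc⁻¹≡1 : χ c⁻¹ ≡ 1#
        χc⁻¹≡1 = trans χ-c⁻¹ (χ-C₀ c c∈C₀)

      Ad≡δ : 𝟙 (C₀? d) ≡ 𝟙 (C₀? two)
      Ad≡δ = same-class d two (trans χ-d (trans (cong (χ two *_) (χ-C₀ c c∈C₀)) (*-identityʳ (χ two))))

    module NonsquareSlope (c∈C₁ : C₁ c) where

      -- 1/c is a nonsquare and -1/c a square.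
      s-at-c⁻¹≡0 : s c⁻¹ ≡ 0
      s-at-c⁻¹≡0 = trans s-at-c⁻¹ (cong₂ ℕ._+_
        (𝟙-no (C₀? c⁻¹) (λ c⁻¹∈C₀ → 1≢-1 (trans (sym (χ-C₀ c⁻¹ c⁻¹∈C₀)) χc⁻¹≡-1)))
        (𝟙-no (C₁? (- c⁻¹)) (λ -c⁻¹∈C₁ → proj₂ -c⁻¹∈C₁ (proj₂ (χ≡1⇒C₀ (- c⁻¹) χ-c⁻¹≡1)))))
        where
        χc⁻¹≡-1 : χ c⁻¹ ≡ - 1#
        χc⁻¹≡-1 = trans χ-c⁻¹ (χ-C₁ c c∈C₁)
        χ-c⁻¹≡1 : χ (- c⁻¹) ≡ 1#
        χ-c⁻¹≡1 = trans (χ-neg-odd c⁻¹) (trans (cong -_ χc⁻¹≡-1) (RingProps.-‿involutive 1#))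

      Ad+δ≡1 : 𝟙 (C₀? d) ℕ.+ 𝟙 (C₀? two) ≡ 1
      Ad+δ≡1 = opposite-class d two two-nonzero (trans χ-d (trans (cong (χ two *_) (χ-C₁ c c∈C₁))
                                                     (solve 1 (λ x → x :* (:- :1) := :- x) refl (χ two))))

module Distribution {q : ℕ} (F : FiniteField q) (k : ℕ) (q≡2k+1 : q ≡ suc (k ℕ.+ k)) where
  open import Data.Nat using (_+_; _*_; _∸_; _/_; _%_)
  open import Relation.Binary.PropositionalEquality

  import Data.Nat.Properties as ℕP
  open import Data.Nat.Tactic.RingSolver using (solve)
  open import Data.List using (_∷_; [])
  open import Data.Product using (_×_; _,_; proj₁)
  open import Data.Sum using (_⊎_; inj₁; inj₂)
  open import Relation.Nullary using (¬_)
  open ≡-Reasoning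

  open Counting
  open FieldFacts F using (0#; two; level)
  open QuadraticCharacter F k q≡2k+1 using (C₀?)
  open Multiplicities F k q≡2k+1 using (f)
  module Slope = NonzeroSlope F k q≡2k+1
  open QuarterArithmetic
  open FF F using (M; C₀; C₁)

  private
    pred-of : ∀ {a b} → a + 1 ≡ b → a ≡ ℕ.pred b
    pred-of {a} a+1≡b = trans (cong ℕ.pred (ℕP.+-comm 1 a)) (cong ℕ.pred a+1≡b)

    +0 : ∀ {a b} → a + 0 ≡ b + 0 → a ≡ b
    +0 {a} {b} = ℕP.+-cancelʳ-≡ 0 a b

    suc-moves : ∀ a b → suc (a + b) ≡ (a + 1) + b
    suc-moves a b = solve (a ∷ b ∷ [])

  one-mod-four : q % 4 ≡ 1 → ∀ c → ¬ c ≡ 0# →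
    M 0 f c ≡ (q + 3) / 4 × M 1 f c ≡ (q ∸ 3) / 2 × M 2 f c ≡ (q + 3) / 4 ×
    (∀ j → j ≢ 0 → j ≢ 1 → j ≢ 2 → M j f c ≡ 0)
  one-mod-four q%4≡1 c c≢0 = at-0 , at-1 , at-2 , elsewhere
    where
    m = q / 4
    k≡2m = k-even q k q≡2k+1 q%4≡1
    open Slope c c≢0
    open EvenCase m k≡2m
    open OneModFour m (trans q≡2k+1 (cong (λ n → suc (n + n)) k≡2m))
    level-1 : level s 1 ≡ m + m
    level-1 = ℕP.+-cancelʳ-≡ (2 * m) (level s 1) (m + m)
      (trans (cong (λ b → level s 1 + 2 * b) (sym β≡m)) (trans level-s-1 (trans (cong₂ _+_ k≡2m k≡2m) (regroup m))))
      where
      regroup : ∀ m → (m + m) + (m + m) ≡ (m + m) + 2 * m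
      regroup m = solve (m ∷ [])
    at-0 : M 0 f c ≡ (q + 3) / 4
    at-0 = trans (M-away s-at-c⁻¹≡1 0 (λ ()) (λ ()))
                 (trans level-s-0 (trans (cong suc β≡m) (sym [q+3]/4)))
    at-1 : M 1 f c ≡ (q ∸ 3) / 2
    at-1 = trans (pred-of (trans (M-shift-at s-at-c⁻¹≡1 1) (trans (ℕP.+-identityʳ _) level-1))) (sym [q-3]/2)
    at-2 : M 2 f c ≡ (q + 3) / 4
    at-2 = trans (+0 (begin
      M 2 f c + 0    ≡⟨ M-shift-at s-at-c⁻¹≡1 2 ⟩
      level s 2 + 1  ≡⟨ cong (_+ 1) (trans level-s-2 β≡m) ⟩
      m + 1          ≡⟨ ℕP.+-comm m 1 ⟩
      suc m          ≡⟨ sym (ℕP.+-identityʳ (suc m)) ⟩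
      suc m + 0      ∎)) (sym [q+3]/4)
    elsewhere : ∀ j → j ≢ 0 → j ≢ 1 → j ≢ 2 → M j f c ≡ 0
    elsewhere j j≢0 j≢1 j≢2 = trans (M-away s-at-c⁻¹≡1 j (λ e → j≢1 (sym e)) (λ e → j≢2 (sym e)))
                                    (level-s-above-2 j j≢0 j≢1 j≢2)

  δ-indicator : ∀ δ → (δ ≡ 1 × C₀ two) ⊎ (δ ≡ 0 × ¬ C₀ two) → δ ≡ 𝟙 (C₀? two)
  δ-indicator δ (inj₁ (δ≡1 , 2∈C₀)) = trans δ≡1 (sym (𝟙-yes (C₀? two) 2∈C₀))
  δ-indicator δ (inj₂ (δ≡0 , 2∉C₀)) = trans δ≡0 (sym (𝟙-no (C₀? two) 2∉C₀))

  three-mod-four-square : q % 4 ≡ 3 → ∀ δ → δ ≡ 𝟙 (C₀? two) → ∀ c → C₀ c →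
    M 0 f c ≡ (q + 5) / 4 ∸ δ × M 1 f c ≡ (q ∸ 3) / 2 + 2 * δ ×
    M 2 f c ≡ (q ∸ 3) / 4 ∸ δ × M 3 f c ≡ 1 ×
    (∀ j → j ≢ 0 → j ≢ 1 → j ≢ 2 → j ≢ 3 → M j f c ≡ 0)
  three-mod-four-square q%4≡3 δ δ≡[2∈C₀] c c∈C₀ = at-0 , at-1 , at-2 , at-3 , elsewhere
    where
    m = q / 4
    k≡2m+1 = k-odd q k q≡2k+1 q%4≡3
    open Slope c (proj₁ c∈C₀)
    open OddCase m k≡2m+1
    open SquareSlope c∈C₀
    open ThreeModFour m (trans q≡2k+1 (cong (λ n → suc (n + n)) k≡2m+1))
    β+δ≡1+m : β + δ ≡ suc m
    β+δ≡1+m = trans (cong (β +_) (trans δ≡[2∈C₀] (sym Ad≡δ))) β+Ad≡1+m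
    at-0 : M 0 f c ≡ (q + 5) / 4 ∸ δ
    at-0 = begin
      M 0 f c              ≡⟨ M-away s-at-c⁻¹≡2 0 (λ ()) (λ ()) ⟩
      level s 0            ≡⟨ level-s-0 ⟩
      suc β                ≡⟨ sym (ℕP.m+n∸n≡m (suc β) δ) ⟩
      suc (β + δ) ∸ δ      ≡⟨ cong (λ n → suc n ∸ δ) β+δ≡1+m ⟩
      suc (suc m) ∸ δ      ≡⟨ cong (_∸ δ) (sym [q+5]/4) ⟩
      (q + 5) / 4 ∸ δ      ∎
    at-1 : M 1 f c ≡ (q ∸ 3) / 2 + 2 * δ
    at-1 = trans (M-away s-at-c⁻¹≡2 1 (λ ()) (λ ())) (ℕP.+-cancelʳ-≡ (2 * β) (level s 1) _ (begin
      level s 1 + 2 * β                ≡⟨ level-s-1 ⟩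
      k + k                            ≡⟨ cong₂ _+_ k≡2m+1 k≡2m+1 ⟩
      suc (m + m) + suc (m + m)        ≡⟨ regroup₁ m ⟩
      (m + m) + 2 * suc m              ≡⟨ cong (λ n → (m + m) + 2 * n) (sym β+δ≡1+m) ⟩
      (m + m) + 2 * (β + δ)            ≡⟨ regroup₂ (m + m) β δ ⟩
      (m + m + 2 * δ) + 2 * β          ≡⟨ cong (λ n → n + 2 * δ + 2 * β) (sym [q-3]/2) ⟩
      (q ∸ 3) / 2 + 2 * δ + 2 * β      ∎))
      where
      regroup₁ : ∀ m → suc (m + m) + suc (m + m) ≡ (m + m) + 2 * suc m
      regroup₁ m = solve (m ∷ [])
      regroup₂ : ∀ n b δ → n + 2 * (b + δ) ≡ (n + 2 * δ) + 2 * b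
      regroup₂ n b δ = solve (n ∷ b ∷ δ ∷ [])
    at-2 : M 2 f c ≡ (q ∸ 3) / 4 ∸ δ
    at-2 = begin
      M 2 f c              ≡⟨ sym (ℕP.m+n∸n≡m (M 2 f c) δ) ⟩
      M 2 f c + δ ∸ δ      ≡⟨ cong (_∸ δ) (ℕP.suc-injective (begin
          suc (M 2 f c + δ)    ≡⟨ suc-moves (M 2 f c) δ ⟩
          (M 2 f c + 1) + δ    ≡⟨ cong (_+ δ) (trans (M-shift-at s-at-c⁻¹≡2 2) (trans (ℕP.+-identityʳ _) level-s-2)) ⟩
          β + δ                ≡⟨ β+δ≡1+m ⟩
          suc m                ∎)) ⟩
      m ∸ δ                ≡⟨ cong (_∸ δ) (sym [q-3]/4) ⟩
      (q ∸ 3) / 4 ∸ δ      ∎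
    at-3 : M 3 f c ≡ 1
    at-3 = +0 (trans (M-shift-at s-at-c⁻¹≡2 3) (cong (_+ 1) (level-s-above-2 3 (λ ()) (λ ()) (λ ()))))
    elsewhere : ∀ j → j ≢ 0 → j ≢ 1 → j ≢ 2 → j ≢ 3 → M j f c ≡ 0
    elsewhere j j≢0 j≢1 j≢2 j≢3 = trans (M-away s-at-c⁻¹≡2 j (λ e → j≢2 (sym e)) (λ e → j≢3 (sym e)))
                                        (level-s-above-2 j j≢0 j≢1 j≢2)

  three-mod-four-nonsquare : q % 4 ≡ 3 → ∀ δ → δ ≡ 𝟙 (C₀? two) → ∀ c → C₁ c →
    M 0 f c ≡ (q ∸ 3) / 4 + δ × M 1 f c ≡ (q + 3) / 2 ∸ 2 * δ × M 2 f c ≡ (q ∸ 3) / 4 + δ ×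
    (∀ j → j ≢ 0 → j ≢ 1 → j ≢ 2 → M j f c ≡ 0)
  three-mod-four-nonsquare q%4≡3 δ δ≡[2∈C₀] c c∈C₁ = at-0 , at-1 , at-2 , elsewhere
    where
    m = q / 4
    k≡2m+1 = k-odd q k q≡2k+1 q%4≡3
    open Slope c (proj₁ c∈C₁)
    open OddCase m k≡2m+1
    open NonsquareSlope c∈C₁
    open ThreeModFour m (trans q≡2k+1 (cong (λ n → suc (n + n)) k≡2m+1))
    β≡m+δ : β ≡ m + δ
    β≡m+δ = ℕP.+-cancelʳ-≡ 1 β (m + δ) (begin
      β + 1                      ≡⟨ cong (β +_) (sym Ad+δ≡1) ⟩
      β + (𝟙 (C₀? d) + 𝟙 (C₀? two)) ≡⟨ sym (ℕP.+-assoc β (𝟙 (C₀? d)) (𝟙 (C₀? two))) ⟩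
      β + 𝟙 (C₀? d) + 𝟙 (C₀? two)   ≡⟨ cong₂ _+_ β+Ad≡1+m (sym δ≡[2∈C₀]) ⟩
      suc m + δ                  ≡⟨ ℕP.+-comm 1 (m + δ) ⟩
      m + δ + 1                  ∎)
    at-0 : M 0 f c ≡ (q ∸ 3) / 4 + δ
    at-0 = begin
      M 0 f c           ≡⟨ ℕP.+-cancelʳ-≡ 1 (M 0 f c) β (trans (M-shift-at s-at-c⁻¹≡0 0)
                             (trans (ℕP.+-identityʳ _) (trans level-s-0 (ℕP.+-comm 1 β)))) ⟩
      β                 ≡⟨ β≡m+δ ⟩
      m + δ             ≡⟨ cong (_+ δ) (sym [q-3]/4) ⟩
      (q ∸ 3) / 4 + δ   ∎
    at-1 : M 1 f c ≡ (q + 3) / 2 ∸ 2 * δ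
    at-1 = begin
      M 1 f c                   ≡⟨ sym (ℕP.m+n∸n≡m (M 1 f c) (2 * δ)) ⟩
      M 1 f c + 2 * δ ∸ 2 * δ   ≡⟨ cong (_∸ 2 * δ) (ℕP.+-cancelʳ-≡ (2 * m) _ _ (begin
          M 1 f c + 2 * δ + 2 * m       ≡⟨ regroup₁ (M 1 f c) δ m ⟩
          (M 1 f c + 0) + 2 * (m + δ)   ≡⟨ cong₂ _+_ (M-shift-at s-at-c⁻¹≡0 1) (cong (2 *_) (sym β≡m+δ)) ⟩
          (level s 1 + 1) + 2 * β       ≡⟨ regroup₂ (level s 1) β ⟩
          suc (level s 1 + 2 * β)       ≡⟨ cong suc (trans level-s-1 (cong₂ _+_ k≡2m+1 k≡2m+1)) ⟩
          suc (suc (m + m) + suc (m + m)) ≡⟨ regroup₃ m ⟩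
          suc (suc (suc (m + m))) + 2 * m ∎)) ⟩
      suc (suc (suc (m + m))) ∸ 2 * δ ≡⟨ cong (_∸ 2 * δ) (sym [q+3]/2) ⟩
      (q + 3) / 2 ∸ 2 * δ       ∎
      where
      regroup₁ : ∀ a δ m → a + 2 * δ + 2 * m ≡ (a + 0) + 2 * (m + δ)
      regroup₁ a δ m = solve (a ∷ δ ∷ m ∷ [])
      regroup₂ : ∀ l b → (l + 1) + 2 * b ≡ suc (l + 2 * b)
      regroup₂ l b = solve (l ∷ b ∷ [])
      regroup₃ : ∀ m → suc (suc (m + m) + suc (m + m)) ≡ suc (suc (suc (m + m))) + 2 * m
      regroup₃ m = solve (m ∷ [])
    at-2 : M 2 f c ≡ (q ∸ 3) / 4 + δ
    at-2 = trans (M-away s-at-c⁻¹≡0 2 (λ ()) (λ ())) (trans level-s-2 (trans β≡m+δ (cong (_+ δ) (sym [q-3]/4))))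
    elsewhere : ∀ j → j ≢ 0 → j ≢ 1 → j ≢ 2 → M j f c ≡ 0
    elsewhere j j≢0 j≢1 j≢2 = trans (M-away s-at-c⁻¹≡0 j (λ e → j≢0 (sym e)) (λ e → j≢1 (sym e)))
                                    (level-s-above-2 j j≢0 j≢1 j≢2)

open import Defs
open import Data.Nat using (ℕ; suc; _+_; _*_; _∸_; _/_; _%_; _<_; _≤_; _^_)
open import Data.Nat.Primality using (Prime)
open import Data.Product using (_×_; _,_)
open import Data.Sum using (_⊎_)
open import Relation.Nullary using (¬_)
open import Relation.Binary.PropositionalEquality using (_≡_; _≢_; subst; sym)

open QuarterArithmetic using (odd-power; half; half-pred)

Conclusion : (q : ℕ) → FiniteField q → ℕ → Set
Conclusion q F h =
  let open FF F
      f = λ (x : Carrier) → x ^ᶠ h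
  in (3 < q →
       M 0 f 0# ≡ q ∸ 3 × M 1 f 0# ≡ 1 × M h f 0# ≡ 2 ×
       (∀ j → j ≢ 0 → j ≢ 1 → j ≢ h → M j f 0# ≡ 0))
   × (q % 4 ≡ 1 → ∀ c → ¬ (c ≡ 0#) →
       M 0 f c ≡ (q + 3) / 4 × M 1 f c ≡ (q ∸ 3) / 2 × M 2 f c ≡ (q + 3) / 4 ×
       (∀ j → j ≢ 0 → j ≢ 1 → j ≢ 2 → M j f c ≡ 0))
   × (q % 4 ≡ 3 → (δ : ℕ) → (δ ≡ 1 × C₀ two) ⊎ (δ ≡ 0 × ¬ C₀ two) →
       (∀ c → C₀ c →
         M 0 f c ≡ (q + 5) / 4 ∸ δ × M 1 f c ≡ (q ∸ 3) / 2 + 2 * δ ×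
         M 2 f c ≡ (q ∸ 3) / 4 ∸ δ × M 3 f c ≡ 1 ×
         (∀ j → j ≢ 0 → j ≢ 1 → j ≢ 2 → j ≢ 3 → M j f c ≡ 0))
       × (∀ c → C₁ c →
         M 0 f c ≡ (q ∸ 3) / 4 + δ × M 1 f c ≡ (q + 3) / 2 ∸ 2 * δ ×
         M 2 f c ≡ (q ∸ 3) / 4 + δ ×
         (∀ j → j ≢ 0 → j ≢ 1 → j ≢ 2 → M j f c ≡ 0)))

conclusion : ∀ {q} (F : FiniteField q) k → q ≡ suc (k + k) → Conclusion q F k
conclusion F k q≡2k+1 =
  zero-slope ,
  one-mod-four ,
  λ q%4≡3 δ δ-def → three-mod-four-square q%4≡3 δ (δ-indicator δ δ-def)
                  , three-mod-four-nonsquare q%4≡3 δ (δ-indicator δ δ-def)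
  where
  open Multiplicities F k q≡2k+1 using (zero-slope)
  open Distribution F k q≡2k+1

-- Proposition B.7.  Only the oddness of q = p^s enters: with k = q / 2 we have
-- q = 2k + 1 and (q - 1) / 2 = k, so the general result applies.
propositionB7 : (p s : ℕ) → Prime p → 1 ≤ s → p % 2 ≡ 1 → (F : FiniteField (p ^ s)) →
    let open FF F
        q = p ^ s
        h = (q ∸ 1) / 2
        f = λ (x : Carrier) → x ^ᶠ h
    in (3 < q →
         M 0 f 0# ≡ q ∸ 3 × M 1 f 0# ≡ 1 × M h f 0# ≡ 2 ×
         (∀ j → j ≢ 0 → j ≢ 1 → j ≢ h → M j f 0# ≡ 0))
     × (q % 4 ≡ 1 → ∀ c → ¬ (c ≡ 0#) →
         M 0 f c ≡ (q + 3) / 4 × M 1 f c ≡ (q ∸ 3) / 2 × M 2 f c ≡ (q + 3) / 4 ×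
         (∀ j → j ≢ 0 → j ≢ 1 → j ≢ 2 → M j f c ≡ 0))
     × (q % 4 ≡ 3 → (δ : ℕ) → (δ ≡ 1 × C₀ two) ⊎ (δ ≡ 0 × ¬ C₀ two) →
         (∀ c → C₀ c →
           M 0 f c ≡ (q + 5) / 4 ∸ δ × M 1 f c ≡ (q ∸ 3) / 2 + 2 * δ ×
           M 2 f c ≡ (q ∸ 3) / 4 ∸ δ × M 3 f c ≡ 1 ×
           (∀ j → j ≢ 0 → j ≢ 1 → j ≢ 2 → j ≢ 3 → M j f c ≡ 0))
         × (∀ c → C₁ c →
           M 0 f c ≡ (q ∸ 3) / 4 + δ × M 1 f c ≡ (q + 3) / 2 ∸ 2 * δ ×
           M 2 f c ≡ (q ∸ 3) / 4 + δ ×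
           (∀ j → j ≢ 0 → j ≢ 1 → j ≢ 2 → M j f c ≡ 0)))
propositionB7 p s _ _ p-odd F =
  subst (Conclusion q F) (sym (half-pred q k q≡2k+1)) (conclusion F k q≡2k+1)
  where
  q = p ^ s
  k = q / 2
  q≡2k+1 : q ≡ suc (k + k)
  q≡2k+1 = half q (odd-power p s p-odd)
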